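{- Let $X$ be an orientable map for which the matrix $\hat C\hat C^T$ has only rational eigenvalues. Assume that $U^\tau=I$ for some integer $\tau>1$ and $U^s\neq I$ for every integer $1\le s<\tau$. Then $\tau\in\{2,3,4,6,12\}$.
   Context: An orientable map $X$ is a 2-cell embedding of a finite connected multigraph (loops and parallel edges allowed) in a closed orientable surface, with vertex set $V$ and face set $F$. Each edge gives two arcs on opposite sides of it, pointing in opposite directions, each lying in a face and oriented along its clockwise facial walk. Let $\mathcal A$ be the arc set, $v(a)$ the tail vertex and $f(a)$ the face of arc $a$; $N\in\{0,1\}^{\mathcal A\times V}$ with $N(a,w)=1$ iff $w=v(a)$; $M\in\{0,1\}^{\mathcal A\times F}$ with $M(a,f)=1$ iff $f=f(a)$; $D=N^TN$, $\Delta=M^TM$; $\hat N=ND^{ -1/2}$, $\hat M=M\Delta^{ -1/2}$, $Q=\hat N\hat N^T$, $P=\hat M\hat M^T$; $U=(2P-I)(2Q-I)$; $\hat C=\hat N^T\hat M$. -}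

module Defs where

open import Data.Nat as ℕ using (ℕ; zero; suc)
open import Data.Fin using (Fin; zero; suc; punchIn)
open import Data.Fin.Permutation using (Permutation′; _⟨$⟩ʳ_)
open import Data.Rational as ℚ using (ℚ; 0ℚ; 1ℚ; _+_; _*_; _-_; -_; 1/_; ≢-nonZero)
open import Data.Rational.Properties using (_≟_)
open import Data.Product using (Σ; ∃; _×_)
open import Relation.Nullary using (yes; no; ¬_)
open import Relation.Binary.PropositionalEquality using (_≡_)

iter : ∀ {n} → (Fin n → Fin n) → ℕ → Fin n → Fin n
iter g zero    a = a
iter g (suc k) a = g (iter g k a)

SameOrbit : ∀ {n} → (Fin n → Fin n) → Fin n → Fin n → Set
SameOrbit g a b = ∃ λ k → iter g k a ≡ b

data Reach {n : ℕ} (g h : Fin n → Fin n) (a : Fin n) : Fin n → Set where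
  here  : Reach g h a a
  stepg : ∀ {b} → Reach g h a b → Reach g h a (g b)
  steph : ∀ {b} → Reach g h a b → Reach g h a (h b)

-- An orientable map with nA arcs (darts), nV vertices and nF faces.
-- α : arc ↦ opposite arc of the same edge (fixed-point-free involution)
-- σ : rotation at vertices; face permutation φ = σ ∘ α.
-- tail : arc ↦ its tail vertex v(a); face : arc ↦ its face f(a);
-- vertices = σ-orbits, faces = φ-orbits; ⟨σ,α⟩ transitive (connected).
record OrientableMap (nA nV nF : ℕ) : Set where
  field
    σ α      : Permutation′ nA
    α-invol  : ∀ a → α ⟨$⟩ʳ (α ⟨$⟩ʳ a) ≡ a
    α-nofix  : ∀ a → ¬ (α ⟨$⟩ʳ a ≡ a)
    tail     : Fin nA → Fin nV
    face     : Fin nA → Fin nF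
    tail-surj : ∀ w → ∃ λ a → tail a ≡ w
    face-surj : ∀ g → ∃ λ a → face a ≡ g
    tail-orbit : ∀ a b → (tail a ≡ tail b → SameOrbit (σ ⟨$⟩ʳ_) a b)
                       × (SameOrbit (σ ⟨$⟩ʳ_) a b → tail a ≡ tail b)
    face-orbit : ∀ a b →
      (face a ≡ face b → SameOrbit (λ x → σ ⟨$⟩ʳ (α ⟨$⟩ʳ x)) a b)
      × (SameOrbit (λ x → σ ⟨$⟩ʳ (α ⟨$⟩ʳ x)) a b → face a ≡ face b)
    connected : ∀ a b → Reach (σ ⟨$⟩ʳ_) (α ⟨$⟩ʳ_) a b
    nonempty  : Fin nA

Mat : ℕ → ℕ → Set
Mat m n = Fin m → Fin n → ℚ

Σ[_] : ∀ {n} → (Fin n → ℚ) → ℚ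
Σ[_] {zero}  f = 0ℚ
Σ[_] {suc n} f = f zero + Σ[_] {n} (λ i → f (suc i))

Π[_] : ∀ {n} → (Fin n → ℚ) → ℚ
Π[_] {zero}  f = 1ℚ
Π[_] {suc n} f = f zero * Π[_] {n} (λ i → f (suc i))

_⊗_ : ∀ {m n k} → Mat m n → Mat n k → Mat m k
(A ⊗ B) i j = Σ[ (λ l → A i l * B l j) ]

infixl 7 _⊗_

_ᵀ : ∀ {m n} → Mat m n → Mat n m
(A ᵀ) i j = A j i

δ : ∀ {n} → Fin n → Fin n → ℚ
δ zero    zero    = 1ℚ
δ zero    (suc j) = 0ℚ
δ (suc i) zero    = 0ℚ
δ (suc i) (suc j) = δ i j

I : ∀ {n} → Mat n n
I = δ

_⊕_ : ∀ {m n} → Mat m n → Mat m n → Mat m n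
(A ⊕ B) i j = A i j + B i j

_·_ : ∀ {m n} → ℚ → Mat m n → Mat m n
(c · A) i j = c * A i j

_^ᴹ_ : ∀ {n} → Mat n n → ℕ → Mat n n
A ^ᴹ zero  = I
A ^ᴹ suc k = A ⊗ (A ^ᴹ k)

_≋_ : ∀ {m n} → Mat m n → Mat m n → Set
A ≋ B = ∀ i j → A i j ≡ B i j

sgn : ℕ → ℚ
sgn zero    = 1ℚ
sgn (suc k) = - sgn k

det : ∀ {n} → Mat n n → ℚ
det {zero}  A = 1ℚ
det {suc n} A =
  Σ[ (λ j → sgn (Data.Fin.toℕ j) * A zero j * det {n} (λ r c → A (suc r) (punchIn j c))) ]

-- total inverse on ℚ (0 ↦ 0); only applied to nonzero degrees below
inv : ℚ → ℚ
inv p with p ≟ 0ℚ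
... | yes _  = 0ℚ
... | no p≢0 = 1/_ p {{≢-nonZero p≢0}}

diagInv : ∀ {n} → Mat n n → Mat n n
diagInv A i j = δ i j * inv (A i i)

module MapMatrices {nA nV nF : ℕ} (X : OrientableMap nA nV nF) where
  open OrientableMap X

  ind : ∀ {k} → Fin k → Fin k → ℚ
  ind x y with Data.Fin._≟_ x y
  ... | yes _ = 1ℚ
  ... | no _  = 0ℚ

  N : Mat nA nV
  N a w = ind (tail a) w

  M : Mat nA nF
  M a g = ind (face a) g

  D : Mat nV nV
  D = N ᵀ ⊗ N

  Δ : Mat nF nF
  Δ = M ᵀ ⊗ M

  -- Q = N̂ N̂ᵀ = N D^{-1/2} D^{-1/2} Nᵀ = N D^{-1} Nᵀ  (rational)
  Q : Mat nA nA
  Q = N ⊗ diagInv D ⊗ N ᵀ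

  -- P = M̂ M̂ᵀ = M Δ^{-1} Mᵀ  (rational)
  P : Mat nA nA
  P = M ⊗ diagInv Δ ⊗ M ᵀ

  U : Mat nA nA
  U = ((2ℚ · P) ⊕ (-1ℚ · I)) ⊗ ((2ℚ · Q) ⊕ (-1ℚ · I))
    where
    2ℚ -1ℚ : ℚ
    2ℚ = 1ℚ + 1ℚ
    -1ℚ = - 1ℚ

  -- K = D^{-1} Nᵀ M Δ^{-1} Mᵀ N = D^{1/2} (Ĉ Ĉᵀ) D^{-1/2}; it is similar
  -- to Ĉ Ĉᵀ, hence has the same characteristic polynomial.
  K : Mat nV nV
  K = diagInv D ⊗ N ᵀ ⊗ M ⊗ diagInv Δ ⊗ M ᵀ ⊗ N

  charPolyCCᵀ : ℚ → ℚ
  charPolyCCᵀ x = det ((x · I) ⊕ ((- 1ℚ) · K))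

  -- Ĉ Ĉᵀ has only rational eigenvalues: its characteristic polynomial
  -- splits into linear factors over ℚ (equality of polynomials of degree nV
  -- checked by evaluation at all rationals, which is equivalent).
  OnlyRationalEigenvalues : Set
  OnlyRationalEigenvalues =
    Σ (Fin nV → ℚ) λ λs → ∀ x → charPolyCCᵀ x ≡ Π[ (λ i → x - λs i) ]

module Submission where

-- With P, Q the projections onto the face and vertex spaces, U = (2P − 1)(2Q − 1) and
-- U + U⁻¹ = 4Y − 2 for Y = 1 − (P − Q)², which commutes with P, Q and U. Moreover YN = NK for
-- K = D⁻¹NᵀMΔ⁻¹MᵀN, which is similar to ĈĈᵀ. If the characteristic polynomial of K splits over ℚ
-- as ∏ᵢ(x − λᵢ), Cayley–Hamilton gives ∏ᵢ(K − λᵢ) = 0, hence ∏ᵢ(Y − λᵢ)·Q = 0 and then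
-- ∏ᵢ(Y − λᵢ)·Y·(Y − 1) = 0. On the kernel of Y − λ the powers of U obey the recurrence
-- u_{k+2} = (4λ − 2) u_{k+1} − u_k; since U has finite order and 4λ − 2 is rational, U¹² = 1
-- there (the crystallographic restriction). Kernels of commuting factors combine, because in
-- characteristic 0 an element of finite order that is unipotent on a vector fixes it. Hence
-- U¹² = I, and the order of U divides 12.

open import Algebra using (CommutativeRing; Ring; RawRing; Semiring)
open import Algebra.Morphism.Structures using (IsRingHomomorphism; IsRingMonomorphism)
import Algebra.Construct.Pointwise as Pointwise
import Algebra.Morphism.RingMonomorphism as RingMonomorphism
open import Data.Empty using (⊥-elim)
open import Data.Fin as Fin using (Fin; zero; suc; punchIn; toℕ)
import Data.Fin.Properties as Fin
open import Data.Integer as ℤ using (ℤ; +_; -[1+_]; +0; +[1+_])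
import Data.Integer.GCD as ℤ
import Data.Integer.Properties as ℤ
import Data.Integer.Tactic.RingSolver as ℤ-Solver
open import Data.List using (List; []; _∷_; map; length)
open import Data.List.Relation.Unary.All using (All; []; _∷_)
open import Data.Maybe using (just; nothing)
open import Data.Nat as ℕ using (ℕ; zero; suc; _<_; _≤_; z≤n; s≤s)
import Data.Nat.Properties as ℕ
open import Data.Nat.Coprimality using (Coprime; coprime-divisor)
import Data.Nat.Coprimality as Coprimality
open import Data.Nat.DivMod using (_%_; _/_; m≡m%n+[m/n]*n; m%n<n)
open import Data.Nat.Divisibility using (_∣_; _∣?_; divides; ∣1⇒≡1; ∣⇒≤; m%n≡0⇒n∣m)
open import Data.Product using (∃; _×_; _,_; proj₁; proj₂)
open import Data.Rational as ℚ using (ℚ; 0ℚ; 1ℚ; mkℚ; ↥_)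
import Data.Rational.Properties as ℚ
import Algebra.Properties.Group (Ring.+-group ℚ.+-*-ring) as ℚ-Group
import Algebra.Properties.Ring ℚ.+-*-ring as ℚ-RingProperties
open import Algebra.Properties.Semiring.Exp (Ring.semiring ℚ.+-*-ring) using () renaming (_^_ to _^ℚ_)
open import Data.Rational.Unnormalised as ℚᵘ using (ℚᵘ; mkℚᵘ; *≡*)
import Data.Rational.Unnormalised.Properties as ℚᵘ
open import Data.Sum using (_⊎_; inj₁; inj₂)
import Data.Vec.Functional as Vec
open import Data.Vec.Functional.Properties using (updateAt-updates; updateAt-minimal; updateAt-id-local)
open import Function using (id; _∘_; _$_; const; flip; case_of_)
open import Level using (0ℓ; _⊔_) renaming (suc to lsuc)
open import Relation.Binary using (tri<; tri≈; tri>)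
open import Relation.Binary.Bundles using (Setoid)
open import Relation.Binary.PropositionalEquality as ≡ using (_≡_; _≢_)
open import Relation.Nullary using (¬_; yes; no)
open import Relation.Nullary.Decidable using (from-no)
open import Tactic.RingSolver using (solve-∀)
open import Tactic.RingSolver.Core.AlmostCommutativeRing using (AlmostCommutativeRing; fromCommutativeRing)

-- Finite sums, products and determinants

module RingSums {c ℓ} (R : Ring c ℓ) where
  open Ring R hiding (zero)
  import Algebra.Properties.Monoid.Sum +-monoid as Sum

  open import Algebra.Properties.Monoid.Sum *-monoid public
    using () renaming (sum to product; sum-cong-≋ to product-cong)

  -- Opaque: a transparent ∑ unfolds at sizes suc n, and then f can no longer be
  -- recovered from ∑ f by unification.
  opaque
    ∑ : ∀ {n} → (Fin n → Carrier) → Carrier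
    ∑ = Sum.sum

    ∑-nil : (f : Fin 0 → Carrier) → ∑ f ≈ 0#
    ∑-nil f = refl

    ∑-suc : ∀ {n} (f : Fin (suc n) → Carrier) → ∑ f ≈ f zero + ∑ (f ∘ suc)
    ∑-suc f = refl

    ∑-cong : ∀ {n} {f g : Fin n → Carrier} → (∀ i → f i ≈ g i) → ∑ f ≈ ∑ g
    ∑-cong = Sum.sum-cong-≋

  product-commutes : ∀ {k} (f : Fin k → Carrier) x → (∀ i → f i * x ≈ x * f i) → product f * x ≈ x * product f
  product-commutes {zero}  f x _       = trans (*-identityˡ x) (sym (*-identityʳ x))
  product-commutes {suc k} f x commute = begin
    (f zero * product (f ∘ suc)) * x  ≈⟨ *-assoc _ _ _ ⟩
    f zero * (product (f ∘ suc) * x)  ≈⟨ *-congˡ (product-commutes (f ∘ suc) x (commute ∘ suc)) ⟩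
    f zero * (x * product (f ∘ suc))  ≈⟨ *-assoc _ _ _ ⟨
    (f zero * x) * product (f ∘ suc)  ≈⟨ *-congʳ (commute zero) ⟩
    (x * f zero) * product (f ∘ suc)  ≈⟨ *-assoc _ _ _ ⟩
    x * (f zero * product (f ∘ suc))  ∎
    where open import Relation.Binary.Reasoning.Setoid setoid

module SemiringPowers {c ℓ} (S : Semiring c ℓ) where
  open Semiring S hiding (zero)
  open import Algebra.Properties.Semiring.Exp S using (_^_; ^-homo-*; ^-assocʳ; ^-congˡ)
  open import Relation.Binary.Reasoning.Setoid setoid

  1#^k≈1# : ∀ k → 1# ^ k ≈ 1#
  1#^k≈1# zero    = refl
  1#^k≈1# (suc k) = trans (*-identityˡ _) (1#^k≈1# k)

  commutes-^ : ∀ {x y} k → y * x ≈ x * y → y * x ^ k ≈ x ^ k * y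
  commutes-^ zero    yx≈xy = trans (*-identityʳ _) (sym (*-identityˡ _))
  commutes-^ {x} {y} (suc k) yx≈xy = begin
    y * (x * x ^ k)  ≈⟨ *-assoc _ _ _ ⟨
    (y * x) * x ^ k  ≈⟨ *-congʳ yx≈xy ⟩
    (x * y) * x ^ k  ≈⟨ *-assoc _ _ _ ⟩
    x * (y * x ^ k)  ≈⟨ *-congˡ (commutes-^ k yx≈xy) ⟩
    x * (x ^ k * y)  ≈⟨ *-assoc _ _ _ ⟨
    (x * x ^ k) * y  ∎

  order-∣ : ∀ {x τ m} → 1 ≤ τ → x ^ τ ≈ 1# → (∀ s → 1 ≤ s → s < τ → ¬ (x ^ s ≈ 1#)) → x ^ m ≈ 1# → τ ∣ m
  order-∣ {x} {τ@(suc _)} {m} _ xᵗ≈1 minimal xᵐ≈1 with m % τ in m%τ≡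
  ... | zero  = m%n≡0⇒n∣m m τ m%τ≡
  ... | suc r = ⊥-elim (minimal (suc r) (s≤s z≤n) (≡.subst (_< τ) m%τ≡ (m%n<n m τ)) (begin
    x ^ suc r
      ≈⟨ *-identityʳ _ ⟨
    x ^ suc r * 1#
      ≈⟨ *-congˡ (trans (^-congˡ (m / τ) xᵗ≈1) (1#^k≈1# (m / τ))) ⟨
    x ^ suc r * (x ^ τ) ^ (m / τ)
      ≈⟨ *-congˡ (trans (^-assocʳ x τ (m / τ)) (reflexive (≡.cong (x ^_) (ℕ.*-comm τ (m / τ))))) ⟩
    x ^ suc r * x ^ (m / τ ℕ.* τ)
      ≈⟨ ^-homo-* x (suc r) _ ⟨
    x ^ (suc r ℕ.+ m / τ ℕ.* τ)
      ≡⟨ ≡.cong (λ k → x ^ (k ℕ.+ m / τ ℕ.* τ)) m%τ≡ ⟨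
    x ^ (m % τ ℕ.+ m / τ ℕ.* τ)
      ≡⟨ ≡.cong (x ^_) (m≡m%n+[m/n]*n m τ) ⟨
    x ^ m
      ≈⟨ xᵐ≈1 ⟩
    1# ∎))

module CommutativeRingSums {c ℓ} (R : CommutativeRing c ℓ) where
  open CommutativeRing R hiding (zero)
  open import Algebra.Properties.Ring ring using (-‿+-comm; -0#≈0#)
  open import Algebra.Properties.Semiring.Sum semiring as Sum using ()
  open RingSums ring public

  opaque
    unfolding ∑

    ∑-zero : ∀ {n} {f : Fin n → Carrier} → (∀ i → f i ≈ 0#) → ∑ f ≈ 0#
    ∑-zero {n} f≈0 = trans (∑-cong f≈0) (Sum.sum-replicate-zero n)

    ∑-neg : ∀ {n} (f : Fin n → Carrier) → ∑ (λ i → - f i) ≈ - ∑ f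
    ∑-neg {zero}  f = sym -0#≈0#
    ∑-neg {suc n} f = trans (+-congˡ (∑-neg (f ∘ suc))) (-‿+-comm _ _)

    ∑-+ : ∀ {n} (f g : Fin n → Carrier) → ∑ (λ i → f i + g i) ≈ ∑ f + ∑ g
    ∑-+ = Sum.∑-distrib-+

    ∑-comm : ∀ {m n} (f : Fin m → Fin n → Carrier) → ∑ (λ i → ∑ (f i)) ≈ ∑ (λ j → ∑ (λ i → f i j))
    ∑-comm = Sum.∑-comm

    ∑-*ˡ : ∀ {n} x (f : Fin n → Carrier) → ∑ (λ i → x * f i) ≈ x * ∑ f
    ∑-*ˡ x f = sym (Sum.*-distribˡ-sum x f)

    ∑-*ʳ : ∀ {n} x (f : Fin n → Carrier) → ∑ (λ i → f i * x) ≈ ∑ f * x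
    ∑-*ʳ x f = sym (Sum.*-distribʳ-sum x f)

    ∑-punchIn : ∀ {n} (j : Fin (suc n)) (f : Fin (suc n) → Carrier) → f j + ∑ (f ∘ punchIn j) ≈ ∑ f
    ∑-punchIn j f = sym (Sum.sum-remove {i = j} f)

mkIsRingHomomorphism : ∀ {a b ℓ₁ ℓ₂} {R₁ : RawRing a ℓ₁} {R₂ : RawRing b ℓ₂}
  (h : RawRing.Carrier R₁ → RawRing.Carrier R₂) →
  let module R₁ = RawRing R₁; module R₂ = RawRing R₂ in
  (∀ {x y} → x R₁.≈ y → h x R₂.≈ h y) →
  (∀ x y → h (x R₁.+ y) R₂.≈ h x R₂.+ h y) → (∀ x y → h (x R₁.* y) R₂.≈ h x R₂.* h y) →
  (∀ x → h (R₁.- x) R₂.≈ R₂.- h x) → h R₁.0# R₂.≈ R₂.0# → h R₁.1# R₂.≈ R₂.1# →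
  IsRingHomomorphism R₁ R₂ h
mkIsRingHomomorphism h cong +-homo *-homo -‿homo 0#-homo 1#-homo = record
  { isSemiringHomomorphism = record
    { isNearSemiringHomomorphism = record
      { +-isMonoidHomomorphism = record
        { isMagmaHomomorphism = record { isRelHomomorphism = record { cong = cong } ; homo = +-homo }
        ; ε-homo = 0#-homo }
      ; *-homo = *-homo }
    ; 1#-homo = 1#-homo }
  ; -‿homo = -‿homo }

module RingHomomorphism {a b ℓ₁ ℓ₂} {R₁ : Ring a ℓ₁} {R₂ : Ring b ℓ₂} {h : Ring.Carrier R₁ → Ring.Carrier R₂}
                        (isHom : IsRingHomomorphism (Ring.rawRing R₁) (Ring.rawRing R₂) h) where
  private
    module R₁ = Ring R₁
    module Σ₁ = RingSums R₁
    module Σ₂ = RingSums R₂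
  open Ring R₂
  open IsRingHomomorphism isHom

  ∑-homo : ∀ {n} (f : Fin n → R₁.Carrier) → h (Σ₁.∑ f) ≈ Σ₂.∑ (h ∘ f)
  ∑-homo {zero}  f = trans (⟦⟧-cong (Σ₁.∑-nil f)) (trans 0#-homo (sym (Σ₂.∑-nil _)))
  ∑-homo {suc n} f = trans (⟦⟧-cong (Σ₁.∑-suc f))
    (trans (+-homo _ _) (trans (+-congˡ (∑-homo (f ∘ suc))) (sym (Σ₂.∑-suc _))))

  product-homo : ∀ {n} (f : Fin n → R₁.Carrier) → h (Σ₁.product f) ≈ Σ₂.product (h ∘ f)
  product-homo {zero}  f = 1#-homo
  product-homo {suc n} f = trans (*-homo _ _) (*-congˡ (product-homo (f ∘ suc)))

-- A total variant of Data.Fin.punchOut; the junk value at c = j is never used.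
punchOut′ : ∀ {m} → Fin (suc (suc m)) → Fin (suc (suc m)) → Fin (suc m)
punchOut′ zero    zero    = zero
punchOut′ zero    (suc c) = c
punchOut′ (suc j) zero    = zero
punchOut′ {zero}  (suc j) (suc c) = zero
punchOut′ {suc m} (suc j) (suc c) = suc (punchOut′ j c)

punchOut′-punchIn : ∀ {m} (j : Fin (suc (suc m))) k → punchOut′ j (punchIn j k) ≡ k
punchOut′-punchIn zero    k       = ≡.refl
punchOut′-punchIn (suc j) zero    = ≡.refl
punchOut′-punchIn {suc m} (suc j) (suc k) = ≡.cong suc (punchOut′-punchIn j k)

punchIn-punchOut′ : ∀ {m} {j c : Fin (suc (suc m))} → j ≢ c → punchIn j (punchOut′ j c) ≡ c
punchIn-punchOut′ {j = zero}  {zero}  j≢c = ⊥-elim (j≢c ≡.refl)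
punchIn-punchOut′ {j = zero}  {suc c} j≢c = ≡.refl
punchIn-punchOut′ {j = suc j} {zero}  j≢c = ≡.refl
punchIn-punchOut′ {zero}  {suc zero} {suc zero} j≢c = ⊥-elim (j≢c ≡.refl)
punchIn-punchOut′ {suc m} {suc j} {suc c} j≢c = ≡.cong suc (punchIn-punchOut′ (j≢c ∘ ≡.cong suc))

punchIn-punchIn-comm : ∀ {m} {j c : Fin (suc (suc m))} → j ≢ c → ∀ x →
  punchIn j (punchIn (punchOut′ j c) x) ≡ punchIn c (punchIn (punchOut′ c j) x)
punchIn-punchIn-comm {j = zero}  {zero}  j≢c x = ⊥-elim (j≢c ≡.refl)
punchIn-punchIn-comm {j = zero}  {suc c} j≢c x = ≡.refl
punchIn-punchIn-comm {j = suc j} {zero}  j≢c x = ≡.refl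
punchIn-punchIn-comm {zero}  {suc zero} {suc zero} j≢c x = ⊥-elim (j≢c ≡.refl)
punchIn-punchIn-comm {suc m} {suc j} {suc c} j≢c zero    = ≡.refl
punchIn-punchIn-comm {suc m} {suc j} {suc c} j≢c (suc x) =
  ≡.cong suc (punchIn-punchIn-comm (j≢c ∘ ≡.cong suc) x)

module Determinant {c ℓ} (R : CommutativeRing c ℓ) where
  open CommutativeRing R hiding (zero)
  open CommutativeRingSums R public
  open import Algebra.Properties.Ring ring using (-‿distribˡ-*; -‿distribʳ-*; -‿involutive)
  open import Algebra.Properties.Group +-group using (∙-cancelˡ)
  open import Algebra.Solver.CommutativeMonoid *-commutativeMonoid using (solve; _⊕_; _⊜_)
  open import Relation.Binary.Reasoning.Setoid setoid

  SqMat : ℕ → Set c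
  SqMat n = Fin n → Fin n → Carrier

  sgn : ℕ → Carrier
  sgn zero    = 1#
  sgn (suc k) = - sgn k

  δ : ∀ {n} → Fin n → Fin n → Carrier
  δ zero    zero    = 1#
  δ zero    (suc j) = 0#
  δ (suc i) zero    = 0#
  δ (suc i) (suc j) = δ i j

  δ-refl : ∀ {n} (i : Fin n) → δ i i ≈ 1#
  δ-refl zero    = refl
  δ-refl (suc i) = δ-refl i

  δ-≢ : ∀ {n} {i j : Fin n} → i ≢ j → δ i j ≈ 0#
  δ-≢ {i = zero}  {zero}  i≢j = ⊥-elim (i≢j ≡.refl)
  δ-≢ {i = zero}  {suc j} i≢j = refl
  δ-≢ {i = suc i} {zero}  i≢j = refl
  δ-≢ {i = suc i} {suc j} i≢j = δ-≢ (i≢j ∘ ≡.cong suc)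

  minor : ∀ {n} → Fin (suc n) → SqMat (suc n) → SqMat n
  minor j A r c = A (suc r) (punchIn j c)

  det : ∀ {n} → SqMat n → Carrier
  det {zero}  A = 1#
  det {suc n} A = ∑ (λ j → sgn (toℕ j) * A zero j * det (minor j A))

  det-cong : ∀ {n} {A B : SqMat n} → (∀ r c → A r c ≈ B r c) → det A ≈ det B
  det-cong {zero}  A≈B = refl
  det-cong {suc n} A≈B =
    ∑-cong (λ j → *-cong (*-cong refl (A≈B zero j)) (det-cong (λ r c → A≈B (suc r) (punchIn j c))))

  neg*neg : ∀ a b → (- a) * (- b) ≈ a * b
  neg*neg a b = trans (sym (-‿distribˡ-* a (- b))) (trans (-‿cong (sym (-‿distribʳ-* a b))) (-‿involutive _))

  sgn*sgn : ∀ k → sgn k * sgn k ≈ 1#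
  sgn*sgn zero    = *-identityˡ 1#
  sgn*sgn (suc k) = trans (neg*neg (sgn k) (sgn k)) (sgn*sgn k)

  sgn*sgn* : ∀ k x → sgn k * (sgn k * x) ≈ x
  sgn*sgn* k x = trans (sym (*-assoc _ _ _)) (trans (*-congʳ (sgn*sgn k)) (*-identityˡ x))

  sgn*x≈0⇒x≈0 : ∀ k {x} → sgn k * x ≈ 0# → x ≈ 0#
  sgn*x≈0⇒x≈0 k {x} sx≈0 = trans (sym (sgn*sgn* k x)) (trans (*-congˡ sx≈0) (zeroʳ _))

  sgn-punchOut′-anticomm : ∀ {m} {j c : Fin (suc (suc m))} → j ≢ c →
    sgn (toℕ j) * sgn (toℕ (punchOut′ j c)) ≈ - (sgn (toℕ c) * sgn (toℕ (punchOut′ c j)))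
  sgn-punchOut′-anticomm {j = zero}  {zero}  j≢c = ⊥-elim (j≢c ≡.refl)
  sgn-punchOut′-anticomm {j = zero}  {suc c} j≢c =
    trans (*-identityˡ _) (sym (trans (-‿cong (*-identityʳ _)) (-‿involutive _)))
  sgn-punchOut′-anticomm {j = suc j} {zero}  j≢c = trans (*-identityʳ _) (-‿cong (sym (*-identityˡ _)))
  sgn-punchOut′-anticomm {zero}  {suc zero} {suc zero} j≢c = ⊥-elim (j≢c ≡.refl)
  sgn-punchOut′-anticomm {suc m} {suc j} {suc c} j≢c =
    trans (neg*neg _ _) (trans (sgn-punchOut′-anticomm (j≢c ∘ ≡.cong suc)) (-‿cong (sym (neg*neg _ _))))

  twoRowTerm : ∀ {n} → SqMat (suc (suc n)) → Fin (suc (suc n)) → Fin (suc (suc n)) → Carrier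
  twoRowTerm A j c = (sgn (toℕ j) * sgn (toℕ (punchOut′ j c))) * (A zero j * A (suc zero) c)
                   * det (λ r x → A (suc (suc r)) (punchIn j (punchIn (punchOut′ j c) x)))

  offDiagonalSum : ∀ {n} → (Fin (suc n) → Fin (suc n) → Carrier) → Carrier
  offDiagonalSum h = ∑ (λ j → ∑ (λ k → h j (punchIn j k)))

  det-expandTwoRows : ∀ {n} (A : SqMat (suc (suc n))) → det A ≈ offDiagonalSum (twoRowTerm A)
  det-expandTwoRows A = ∑-cong λ j → begin
    sgn (toℕ j) * A zero j * det (minor j A)
      ≈⟨ ∑-*ˡ _ _ ⟨
    ∑ (λ k → sgn (toℕ j) * A zero j * (sgn (toℕ k) * A (suc zero) (punchIn j k) * det (minor k (minor j A))))
      ≈⟨ ∑-cong (λ k → trans (regroup _ _ _ _ _) (reflexive (reindex j k))) ⟩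
    ∑ (λ k → twoRowTerm A j (punchIn j k)) ∎
    where
    regroup : ∀ a b c d e → a * b * (c * d * e) ≈ (a * c) * (b * d) * e
    regroup = solve 5 (λ a b c d e → (a ⊕ b) ⊕ ((c ⊕ d) ⊕ e) ⊜ ((a ⊕ c) ⊕ (b ⊕ d)) ⊕ e) refl
    reindex : ∀ j k → (sgn (toℕ j) * sgn (toℕ k)) * (A zero j * A (suc zero) (punchIn j k))
                      * det (minor k (minor j A))
                    ≡ twoRowTerm A j (punchIn j k)
    reindex j k = ≡.cong (λ k′ → (sgn (toℕ j) * sgn (toℕ k′)) * (A zero j * A (suc zero) (punchIn j k))
                                 * det (λ r x → A (suc (suc r)) (punchIn j (punchIn k′ x))))
                         (≡.sym (punchOut′-punchIn j k))

  diagonal+offDiagonal : ∀ {n} (h : Fin (suc n) → Fin (suc n) → Carrier) →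
                         ∑ (λ j → h j j) + offDiagonalSum h ≈ ∑ (λ j → ∑ (h j))
  diagonal+offDiagonal h = trans (sym (∑-+ _ _)) (∑-cong (λ j → ∑-punchIn j (h j)))

  offDiagonalSum-flip : ∀ {n} (h : Fin (suc n) → Fin (suc n) → Carrier) →
                        offDiagonalSum (flip h) ≈ offDiagonalSum h
  offDiagonalSum-flip h = ∙-cancelˡ (∑ (λ j → h j j)) _ _ (begin
    ∑ (λ j → h j j) + offDiagonalSum (flip h)  ≈⟨ diagonal+offDiagonal (flip h) ⟩
    ∑ (λ j → ∑ (λ c → h c j))                  ≈⟨ ∑-comm (flip h) ⟩
    ∑ (λ c → ∑ (h c))                          ≈⟨ diagonal+offDiagonal h ⟨
    ∑ (λ j → h j j) + offDiagonalSum h         ∎)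

  swapRows₀₁ : ∀ {a} {X : Set a} {n} → (Fin (suc (suc n)) → X) → Fin (suc (suc n)) → X
  swapRows₀₁ A = A (suc zero) Vec.∷ A zero Vec.∷ Vec.tail (Vec.tail A)

  det-swapRows₀₁ : ∀ {n} (A : SqMat (suc (suc n))) → det (swapRows₀₁ A) ≈ - det A
  det-swapRows₀₁ {n} A = begin
    det (swapRows₀₁ A)                                  ≈⟨ det-expandTwoRows (swapRows₀₁ A) ⟩
    offDiagonalSum (twoRowTerm (swapRows₀₁ A))          ≈⟨ ∑-cong (λ j → ∑-cong (λ k → swapped j k)) ⟩
    ∑ (λ j → ∑ (λ k → - twoRowTerm A (punchIn j k) j))  ≈⟨ ∑-cong (λ j → ∑-neg _) ⟩
    ∑ (λ j → - ∑ (λ k → twoRowTerm A (punchIn j k) j))  ≈⟨ ∑-neg _ ⟩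
    - offDiagonalSum (flip (twoRowTerm A))              ≈⟨ -‿cong (offDiagonalSum-flip (twoRowTerm A)) ⟩
    - offDiagonalSum (twoRowTerm A)                     ≈⟨ -‿cong (det-expandTwoRows A) ⟨
    - det A                                             ∎
    where
    swapped : ∀ j k → twoRowTerm (swapRows₀₁ A) j (punchIn j k) ≈ - twoRowTerm A (punchIn j k) j
    swapped j k = begin
      (sgn (toℕ j) * sgn (toℕ (punchOut′ j j′))) * (A (suc zero) j * A zero j′) * _
        ≈⟨ *-cong (*-cong (sgn-punchOut′-anticomm j≢c) (*-comm _ _))
                  (det-cong (λ r x → reflexive (≡.cong (A (suc (suc r))) (punchIn-punchIn-comm j≢c x)))) ⟩
      (- (sgn (toℕ j′) * sgn (toℕ (punchOut′ j′ j)))) * (A zero j′ * A (suc zero) j) * _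
        ≈⟨ trans (*-congʳ (sym (-‿distribˡ-* _ _))) (sym (-‿distribˡ-* _ _)) ⟩
      - twoRowTerm A j′ j ∎
      where
      j′ : Fin (suc (suc n))
      j′ = punchIn j k
      j≢c : j ≢ j′
      j≢c = Fin.punchInᵢ≢i j k ∘ ≡.sym

  moveRowToTop : ∀ {a} {X : Set a} {n} → Fin (suc n) → (Fin (suc n) → X) → Fin (suc n) → X
  moveRowToTop i A = A i Vec.∷ Vec.removeAt A i

  det-scaleMinors : ∀ {n} (A B : SqMat (suc n)) s → (∀ j → B zero j ≈ A zero j) →
                    (∀ j → det (minor j B) ≈ s * det (minor j A)) → det B ≈ s * det A
  det-scaleMinors A B s row₀ minors = trans (∑-cong term) (∑-*ˡ _ _)
    where
    term : ∀ j → sgn (toℕ j) * B zero j * det (minor j B) ≈ s * (sgn (toℕ j) * A zero j * det (minor j A))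
    term j = trans (*-cong (*-cong refl (row₀ j)) (minors j))
                   (solve 4 (λ a b c d → (a ⊕ b) ⊕ (c ⊕ d) ⊜ c ⊕ ((a ⊕ b) ⊕ d)) refl _ _ _ _)

  mutual
    det-moveRowToTop : ∀ {n} (i : Fin (suc n)) (A : SqMat (suc n)) → det (moveRowToTop i A) ≈ sgn (toℕ i) * det A
    det-moveRowToTop zero A = trans (det-cong same) (sym (*-identityˡ _))
      where
      same : ∀ r c → moveRowToTop zero A r c ≈ A r c
      same zero    c = refl
      same (suc r) c = refl
    det-moveRowToTop {suc n} (suc i) A = begin
      det (moveRowToTop (suc i) A)  ≈⟨ det-cong same ⟩
      det (swapRows₀₁ B)            ≈⟨ det-swapRows₀₁ B ⟩
      - det B                       ≈⟨ -‿cong (det-moveRowToTop-below i A) ⟩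
      - (sgn (toℕ i) * det A)       ≈⟨ -‿distribˡ-* _ _ ⟩
      sgn (toℕ (suc i)) * det A     ∎
      where
      B : SqMat (suc (suc n))
      B = Vec.head A Vec.∷ moveRowToTop i (Vec.tail A)
      same : ∀ r c → moveRowToTop (suc i) A r c ≈ swapRows₀₁ B r c
      same zero          c = refl
      same (suc zero)    c = refl
      same (suc (suc r)) c = refl

    det-moveRowToTop-below : ∀ {n} (i : Fin (suc n)) (A : SqMat (suc (suc n))) →
                             det (Vec.head A Vec.∷ moveRowToTop i (Vec.tail A)) ≈ sgn (toℕ i) * det A
    det-moveRowToTop-below i A =
      det-scaleMinors A (Vec.head A Vec.∷ moveRowToTop i (Vec.tail A)) (sgn (toℕ i)) (λ j → refl)
      (λ j → trans (det-cong (same j)) (det-moveRowToTop i (minor j A)))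
      where
      same : ∀ j r c → minor j (Vec.head A Vec.∷ moveRowToTop i (Vec.tail A)) r c ≈ moveRowToTop i (minor j A) r c
      same j zero    c = refl
      same j (suc r) c = refl

  det-expandRow : ∀ {n} (i : Fin (suc n)) (A : SqMat (suc n)) →
                  det A ≈ sgn (toℕ i) * ∑ (λ j → sgn (toℕ j) * A i j * det (λ r c → A (punchIn i r) (punchIn j c)))
  det-expandRow i A = begin
    det A                                 ≈⟨ sgn*sgn* (toℕ i) (det A) ⟨
    sgn (toℕ i) * (sgn (toℕ i) * det A)   ≈⟨ *-congˡ (det-moveRowToTop i A) ⟨
    sgn (toℕ i) * det (moveRowToTop i A)  ∎

  adj : ∀ {n} → SqMat (suc n) → SqMat (suc n)
  adj A j k = sgn (toℕ k) * sgn (toℕ j) * det (λ r c → A (punchIn k r) (punchIn j c))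

  module WithHalf (½ : Carrier) (½+½≈1 : ½ + ½ ≈ 1#) where

    x≈-x⇒x≈0 : ∀ {x} → x ≈ - x → x ≈ 0#
    x≈-x⇒x≈0 {x} x≈-x = begin
      x              ≈⟨ *-identityˡ x ⟨
      1# * x         ≈⟨ *-congʳ ½+½≈1 ⟨
      (½ + ½) * x    ≈⟨ distribʳ x ½ ½ ⟩
      ½ * x + ½ * x  ≈⟨ distribˡ ½ x x ⟨
      ½ * (x + x)    ≈⟨ *-congˡ (+-congˡ x≈-x) ⟩
      ½ * (x + - x)  ≈⟨ *-congˡ (-‿inverseʳ x) ⟩
      ½ * 0#         ≈⟨ zeroʳ ½ ⟩
      0#             ∎

    -- Move row r to the top and then row r′ just below it; swapping the two
    -- top rows then changes nothing but negates the determinant.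
    det-equalRows : ∀ {n} (A : SqMat (suc n)) {r r′} → r ≢ r′ → (∀ c → A r c ≈ A r′ c) → det A ≈ 0#
    det-equalRows {zero}  A {zero} {zero} r≢r′ rows≈ = ⊥-elim (r≢r′ ≡.refl)
    det-equalRows {suc m} A {r} {r′} r≢r′ rows≈ =
      sgn*x≈0⇒x≈0 (toℕ r) (trans (sym (det-moveRowToTop r A))
        (sgn*x≈0⇒x≈0 (toℕ t) (trans (sym (det-moveRowToTop-below t A′)) det-A″≈0)))
      where
      A′ A″ : SqMat (suc (suc m))
      A′ = moveRowToTop r A
      t : Fin (suc m)
      t = punchOut′ r r′
      A″ = Vec.head A′ Vec.∷ moveRowToTop t (Vec.tail A′)
      row₁ : ∀ c → A (punchIn r t) c ≈ A r c
      row₁ c = trans (reflexive (≡.cong (λ z → A z c) (punchIn-punchOut′ r≢r′))) (sym (rows≈ c))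
      swap-same : ∀ i c → swapRows₀₁ A″ i c ≈ A″ i c
      swap-same zero          c = row₁ c
      swap-same (suc zero)    c = sym (row₁ c)
      swap-same (suc (suc i)) c = refl
      det-A″≈0 : det A″ ≈ 0#
      det-A″≈0 = x≈-x⇒x≈0 (trans (sym (det-cong swap-same)) (det-swapRows₀₁ A″))

    det-replaceRow : ∀ {n} (A : SqMat (suc n)) i k → det (Vec.updateAt A k (const (A i))) ≈ δ i k * det A
    det-replaceRow A i k with i Fin.≟ k
    ... | yes ≡.refl = trans (det-cong (λ r c → reflexive (≡.cong (_$ c) (updateAt-id-local i A ≡.refl r))))
                             (sym (trans (*-congʳ (δ-refl i)) (*-identityˡ _)))
    ... | no i≢k = trans (det-equalRows (Vec.updateAt A k (const (A i))) i≢k (λ c → reflexive (≡.cong (_$ c)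
                           (≡.trans (updateAt-minimal i k A i≢k) (≡.sym (updateAt-updates k {const (A i)} A))))))
                         (sym (trans (*-congʳ (δ-≢ i≢k)) (zeroˡ _)))

    adj-rightInverse : ∀ {n} (A : SqMat (suc n)) i k → ∑ (λ j → A i j * adj A j k) ≈ δ i k * det A
    adj-rightInverse {n} A i k = begin
      ∑ (λ j → A i j * adj A j k)
        ≈⟨ ∑-cong term ⟩
      ∑ (λ j → sgn (toℕ k) * (sgn (toℕ j) * A′ k j * det (λ r c → A′ (punchIn k r) (punchIn j c))))
        ≈⟨ ∑-*ˡ _ _ ⟩
      sgn (toℕ k) * ∑ (λ j → sgn (toℕ j) * A′ k j * det (λ r c → A′ (punchIn k r) (punchIn j c)))
        ≈⟨ det-expandRow k A′ ⟨
      det A′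
        ≈⟨ det-replaceRow A i k ⟩
      δ i k * det A ∎
      where
      A′ : SqMat (suc n)
      A′ = Vec.updateAt A k (const (A i))
      regroup : ∀ a b c d → a * (b * c * d) ≈ b * (c * a * d)
      regroup = solve 4 (λ a b c d → a ⊕ ((b ⊕ c) ⊕ d) ⊜ b ⊕ ((c ⊕ a) ⊕ d)) refl
      row-k : ∀ j → A i j ≡ A′ k j
      row-k j = ≡.cong (_$ j) (≡.sym (updateAt-updates k A))
      other-rows : ∀ j r c → A (punchIn k r) (punchIn j c) ≈ A′ (punchIn k r) (punchIn j c)
      other-rows j r c = reflexive (≡.cong (_$ punchIn j c) (≡.sym (updateAt-minimal _ k A (Fin.punchInᵢ≢i k r))))
      term : ∀ j → A i j * adj A j k
                   ≈ sgn (toℕ k) * (sgn (toℕ j) * A′ k j * det (λ r c → A′ (punchIn k r) (punchIn j c)))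
      term j = trans (regroup _ _ _ _) (*-congˡ (*-cong (*-congˡ (reflexive (row-k j))) (det-cong (other-rows j))))

module DeterminantHomomorphism {a b ℓ₁ ℓ₂} {R₁ : CommutativeRing a ℓ₁} {R₂ : CommutativeRing b ℓ₂}
  {h : CommutativeRing.Carrier R₁ → CommutativeRing.Carrier R₂}
  (isHom : IsRingHomomorphism (CommutativeRing.rawRing R₁) (CommutativeRing.rawRing R₂) h) where
  private
    module D₁ = Determinant R₁
    module D₂ = Determinant R₂
  open CommutativeRing R₂
  open IsRingHomomorphism isHom
  open RingHomomorphism {R₁ = CommutativeRing.ring R₁} {R₂ = CommutativeRing.ring R₂} isHom using (∑-homo)

  sgn-homo : ∀ k → h (D₁.sgn k) ≈ D₂.sgn k
  sgn-homo zero    = 1#-homo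
  sgn-homo (suc k) = trans (-‿homo _) (-‿cong (sgn-homo k))

  det-homo : ∀ {n} (A : D₁.SqMat n) → h (D₁.det A) ≈ D₂.det (λ i j → h (A i j))
  det-homo {zero}  A = 1#-homo
  det-homo {suc n} A = trans (∑-homo _) (D₂.∑-cong λ j →
    trans (*-homo _ _) (*-cong (trans (*-homo _ _) (*-cong (sgn-homo (toℕ j)) refl)) (det-homo (D₁.minor j A))))

-- ℚ-algebras and polynomials

ℚ-almostCommutativeRing : AlmostCommutativeRing 0ℓ 0ℓ
ℚ-almostCommutativeRing = fromCommutativeRing ℚ.+-*-commutativeRing isZero
  where
  isZero : ∀ x → _
  isZero x = case x ℚ.≟ 0ℚ of λ { (yes x≡0) → just (≡.sym x≡0) ; (no _) → nothing }

record ℚAlgebra c ℓ : Set (lsuc (c ⊔ ℓ)) where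
  field
    ring : Ring c ℓ
    ι : ℚ → Ring.Carrier ring
    ι-isRingHomomorphism : IsRingHomomorphism (Ring.rawRing ℚ.+-*-ring) (Ring.rawRing ring) ι
    ι-central : ∀ a x → Ring._≈_ ring (Ring._*_ ring (ι a) x) (Ring._*_ ring x (ι a))

  open Ring ring public
  open IsRingHomomorphism ι-isRingHomomorphism public
    using () renaming (+-homo to ι-+; *-homo to ι-*; -‿homo to ι-neg; 0#-homo to ι-0; 1#-homo to ι-1)

ℚ-ℚAlgebra : ℚAlgebra 0ℓ 0ℓ
ℚ-ℚAlgebra = record
  { ring = ℚ.+-*-ring
  ; ι = id
  ; ι-isRingHomomorphism = mkIsRingHomomorphism id id (λ _ _ → ≡.refl) (λ _ _ → ≡.refl) (λ _ → ≡.refl) ≡.refl ≡.refl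
  ; ι-central = ℚ.*-comm
  }

-- Coefficient lists, constant term first.
Pol : Set
Pol = List ℚ

infixl 6 _+ₚ_
infixl 7 _*ₚ_

_+ₚ_ : Pol → Pol → Pol
[]      +ₚ q       = q
(a ∷ p) +ₚ []      = a ∷ p
(a ∷ p) +ₚ (b ∷ q) = (a ℚ.+ b) ∷ (p +ₚ q)

_*ₚ_ : Pol → Pol → Pol
[]      *ₚ q = []
(a ∷ p) *ₚ q = map (a ℚ.*_) q +ₚ (0ℚ ∷ p *ₚ q)

-ₚ_ : Pol → Pol
-ₚ p = map ℚ.-_ p

X-_ : ℚ → Pol
X- a = ℚ.- a ∷ 1ℚ ∷ []

module Evaluation {c ℓ} (A : ℚAlgebra c ℓ) where
  open ℚAlgebra A
  open import Relation.Binary.Reasoning.Setoid setoid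
  open import Algebra.Properties.Ring ring using (-‿distribʳ-*; -0#≈0#; -‿+-comm)
  open import Algebra.Properties.CommutativeSemigroup +-commutativeSemigroup using (interchange)

  eval : Carrier → Pol → Carrier
  eval x []      = 0#
  eval x (a ∷ p) = ι a + x * eval x p

  module _ (x : Carrier) where

    eval-+ : ∀ p q → eval x (p +ₚ q) ≈ eval x p + eval x q
    eval-+ []      q       = sym (+-identityˡ _)
    eval-+ (a ∷ p) []      = sym (+-identityʳ _)
    eval-+ (a ∷ p) (b ∷ q) = begin
      ι (a ℚ.+ b) + x * eval x (p +ₚ q)            ≈⟨ +-cong (ι-+ a b) (*-congˡ (eval-+ p q)) ⟩
      (ι a + ι b) + x * (eval x p + eval x q)      ≈⟨ +-congˡ (distribˡ _ _ _) ⟩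
      (ι a + ι b) + (x * eval x p + x * eval x q)  ≈⟨ interchange _ _ _ _ ⟩
      (ι a + x * eval x p) + (ι b + x * eval x q)  ∎

    eval-scale : ∀ a p → eval x (map (a ℚ.*_) p) ≈ ι a * eval x p
    eval-scale a []      = sym (zeroʳ _)
    eval-scale a (b ∷ p) = begin
      ι (a ℚ.* b) + x * eval x (map (a ℚ.*_) p) ≈⟨ +-cong (ι-* a b) (*-congˡ (eval-scale a p)) ⟩
      ι a * ι b + x * (ι a * eval x p)     ≈⟨ +-congˡ (trans (sym (*-assoc _ _ _)) (*-congʳ (sym (ι-central a x)))) ⟩
      ι a * ι b + (ι a * x) * eval x p     ≈⟨ +-congˡ (*-assoc _ _ _) ⟩
      ι a * ι b + ι a * (x * eval x p)     ≈⟨ distribˡ _ _ _ ⟨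
      ι a * (ι b + x * eval x p)           ∎

    eval-* : ∀ p q → eval x (p *ₚ q) ≈ eval x p * eval x q
    eval-* []      q = sym (zeroˡ _)
    eval-* (a ∷ p) q = begin
      eval x (map (a ℚ.*_) q +ₚ (0ℚ ∷ p *ₚ q))
        ≈⟨ eval-+ (map (a ℚ.*_) q) _ ⟩
      eval x (map (a ℚ.*_) q) + (ι 0ℚ + x * eval x (p *ₚ q))
        ≈⟨ +-cong (eval-scale a q) (+-cong ι-0 (*-congˡ (eval-* p q))) ⟩
      ι a * eval x q + (0# + x * (eval x p * eval x q))
        ≈⟨ +-congˡ (trans (+-identityˡ _) (sym (*-assoc _ _ _))) ⟩
      ι a * eval x q + (x * eval x p) * eval x q
        ≈⟨ distribʳ _ _ _ ⟨
      (ι a + x * eval x p) * eval x q ∎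

    eval-neg : ∀ p → eval x (-ₚ p) ≈ - eval x p
    eval-neg []      = sym -0#≈0#
    eval-neg (a ∷ p) = begin
      ι (ℚ.- a) + x * eval x (-ₚ p)  ≈⟨ +-cong (ι-neg a) (*-congˡ (eval-neg p)) ⟩
      - ι a + x * - eval x p         ≈⟨ +-congˡ (sym (-‿distribʳ-* _ _)) ⟩
      - ι a + - (x * eval x p)       ≈⟨ -‿+-comm _ _ ⟩
      - (ι a + x * eval x p)         ∎

    eval-1 : eval x (1ℚ ∷ []) ≈ 1#
    eval-1 = trans (+-cong ι-1 (zeroʳ x)) (+-identityʳ 1#)

    eval-X- : ∀ a → eval x (X- a) ≈ ι (ℚ.- a) + x
    eval-X- a = +-congˡ (trans (*-congˡ (trans (+-cong ι-1 (zeroʳ x)) (+-identityʳ 1#))) (*-identityʳ x))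

    eval-zeros : ∀ {p} → All (_≡ 0ℚ) p → eval x p ≈ 0#
    eval-zeros []             = refl
    eval-zeros (≡.refl ∷ p≈0) = trans (+-cong ι-0 (trans (*-congˡ (eval-zeros p≈0)) (zeroʳ x))) (+-identityˡ 0#)

open Evaluation ℚ-ℚAlgebra using () renaming
  (eval to evalℚ; eval-+ to evalℚ-+; eval-* to evalℚ-*; eval-neg to evalℚ-neg; eval-1 to evalℚ-1)

module ℚAlgebraProperties {c ℓ} (A : ℚAlgebra c ℓ) where
  open ℚAlgebra A
  open import Algebra.Properties.Ring ring using (-‿distribˡ-*; -‿+-comm)
  open import Algebra.Properties.CommutativeSemigroup +-commutativeSemigroup using (interchange)
  open import Relation.Binary.Reasoning.Setoid setoid

  ι-*-assoc : ∀ a b x → ι a * (ι b * x) ≈ ι (a ℚ.* b) * x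
  ι-*-assoc a b x = trans (sym (*-assoc _ _ _)) (*-congʳ (sym (ι-* a b)))

  ι-pull : ∀ a x y → x * (ι a * y) ≈ ι a * (x * y)
  ι-pull a x y = trans (sym (*-assoc _ _ _)) (trans (*-congʳ (sym (ι-central a x))) (*-assoc _ _ _))

  ι-*-sub : ∀ a b x → ι a * x - ι b * x ≈ ι (a ℚ.- b) * x
  ι-*-sub a b x = begin
    ι a * x - ι b * x        ≈⟨ +-congˡ (trans (-‿distribˡ-* _ _) (*-congʳ (sym (ι-neg b)))) ⟩
    ι a * x + ι (ℚ.- b) * x  ≈⟨ distribʳ _ _ _ ⟨
    (ι a + ι (ℚ.- b)) * x    ≈⟨ *-congʳ (ι-+ _ _) ⟨
    ι (a ℚ.- b) * x          ∎

  ι-linearStep : ∀ c a₀ b₀ a₁ b₁ X Y →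
    ι c * (ι a₁ * X + ι b₁ * Y) - (ι a₀ * X + ι b₀ * Y) ≈ ι (c ℚ.* a₁ ℚ.- a₀) * X + ι (c ℚ.* b₁ ℚ.- b₀) * Y
  ι-linearStep c a₀ b₀ a₁ b₁ X Y = begin
    ι c * (ι a₁ * X + ι b₁ * Y) - (ι a₀ * X + ι b₀ * Y)
      ≈⟨ +-cong (trans (distribˡ _ _ _) (+-cong (ι-*-assoc c a₁ X) (ι-*-assoc c b₁ Y))) (sym (-‿+-comm _ _)) ⟩
    (ι (c ℚ.* a₁) * X + ι (c ℚ.* b₁) * Y) + (- (ι a₀ * X) + - (ι b₀ * Y))
      ≈⟨ interchange _ _ _ _ ⟩
    (ι (c ℚ.* a₁) * X - ι a₀ * X) + (ι (c ℚ.* b₁) * Y - ι b₀ * Y)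
      ≈⟨ +-cong (ι-*-sub (c ℚ.* a₁) a₀ X) (ι-*-sub (c ℚ.* b₁) b₀ Y) ⟩
    ι (c ℚ.* a₁ ℚ.- a₀) * X + ι (c ℚ.* b₁ ℚ.- b₀) * Y ∎

  ι-neg1* : ∀ x → ι (ℚ.- 1ℚ) * x ≈ - x
  ι-neg1* x = trans (*-congʳ (trans (ι-neg 1ℚ) (-‿cong ι-1))) (trans (sym (-‿distribˡ-* 1# x)) (-‿cong (*-identityˡ x)))

  ι-cancel : ∀ {a y} → a ≢ 0ℚ → ι a * y ≈ 0# → y ≈ 0#
  ι-cancel {a} {y} a≢0 ay≈0 = begin
    y                  ≈⟨ *-identityˡ y ⟨
    1# * y             ≈⟨ *-congʳ (trans (sym ι-1) (reflexive (≡.cong ι (≡.sym (ℚ.*-inverseˡ a))))) ⟩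
    ι (a⁻¹ ℚ.* a) * y  ≈⟨ trans (*-congʳ (ι-* _ _)) (*-assoc _ _ _) ⟩
    ι a⁻¹ * (ι a * y)  ≈⟨ *-congˡ ay≈0 ⟩
    ι a⁻¹ * 0#         ≈⟨ zeroʳ _ ⟩
    0#                 ∎
    where
    instance
      a≢0′ : ℚ.NonZero a
      a≢0′ = ℚ.≢-nonZero a≢0
    a⁻¹ : ℚ
    a⁻¹ = ℚ.1/ a

open ℚAlgebraProperties ℚ-ℚAlgebra using () renaming (ι-cancel to ℚ-cancel)

quotientByX- : ℚ → Pol → Pol
quotientByX- a []          = []
quotientByX- a (c ∷ [])    = []
quotientByX- a (c ∷ d ∷ r) = evalℚ a (d ∷ r) ∷ quotientByX- a (d ∷ r)

length-quotientByX- : ∀ a c q → length (quotientByX- a (c ∷ q)) ≡ length q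
length-quotientByX- a c []      = ≡.refl
length-quotientByX- a c (d ∷ r) = ≡.cong suc (length-quotientByX- a d r)

evalℚ-quotientByX- : ∀ x a p → evalℚ x p ≡ evalℚ a p ℚ.+ (x ℚ.- a) ℚ.* evalℚ x (quotientByX- a p)
evalℚ-quotientByX- x a []          = zero-case x a
  where
  zero-case : ∀ x a → 0ℚ ≡ 0ℚ ℚ.+ (x ℚ.- a) ℚ.* 0ℚ
  zero-case = solve-∀ ℚ-almostCommutativeRing
evalℚ-quotientByX- x a (c ∷ [])    = constant-case x a c
  where
  constant-case : ∀ x a c → c ℚ.+ x ℚ.* 0ℚ ≡ (c ℚ.+ a ℚ.* 0ℚ) ℚ.+ (x ℚ.- a) ℚ.* 0ℚ
  constant-case = solve-∀ ℚ-almostCommutativeRing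
evalℚ-quotientByX- x a (c ∷ d ∷ r) = begin
  c ℚ.+ x ℚ.* evalℚ x (d ∷ r)
    ≡⟨ ≡.cong (λ e → c ℚ.+ x ℚ.* e) (evalℚ-quotientByX- x a (d ∷ r)) ⟩
  c ℚ.+ x ℚ.* (qa ℚ.+ (x ℚ.- a) ℚ.* qx)
    ≡⟨ regroup x a c qa qx ⟩
  (c ℚ.+ a ℚ.* qa) ℚ.+ (x ℚ.- a) ℚ.* (qa ℚ.+ x ℚ.* qx) ∎
  where
  open ≡.≡-Reasoning
  qa qx : ℚ
  qa = evalℚ a (d ∷ r)
  qx = evalℚ x (quotientByX- a (d ∷ r))
  regroup : ∀ x a c qa qx → c ℚ.+ x ℚ.* (qa ℚ.+ (x ℚ.- a) ℚ.* qx) ≡ (c ℚ.+ a ℚ.* qa) ℚ.+ (x ℚ.- a) ℚ.* (qa ℚ.+ x ℚ.* qx)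
  regroup = solve-∀ ℚ-almostCommutativeRing

zeros-quotientByX- : ∀ a p → All (_≡ 0ℚ) (quotientByX- a p) → evalℚ a p ≡ 0ℚ → All (_≡ 0ℚ) p
zeros-quotientByX- a []          _ _ = []
zeros-quotientByX- a (c ∷ [])    _ pa≡0 = ≡.trans (c≡c+a*0 a c) pa≡0 ∷ []
  where
  c≡c+a*0 : ∀ a c → c ≡ c ℚ.+ a ℚ.* 0ℚ
  c≡c+a*0 = solve-∀ ℚ-almostCommutativeRing
zeros-quotientByX- a (c ∷ d ∷ r) (qa≡0 ∷ q≡0) pa≡0 = c≡0 ∷ zeros-quotientByX- a (d ∷ r) q≡0 qa≡0
  where
  c≡0 : c ≡ 0ℚ
  c≡0 = begin
    c                                                        ≡⟨ add-sub a c (evalℚ a (d ∷ r)) ⟩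
    (c ℚ.+ a ℚ.* evalℚ a (d ∷ r)) ℚ.- a ℚ.* evalℚ a (d ∷ r)  ≡⟨ ≡.cong₂ (λ u v → u ℚ.- a ℚ.* v) pa≡0 qa≡0 ⟩
    0ℚ ℚ.- a ℚ.* 0ℚ                                          ≡⟨ 0-a*0≡0 a ⟩
    0ℚ                                                       ∎
    where
    open ≡.≡-Reasoning
    add-sub : ∀ a c e → c ≡ (c ℚ.+ a ℚ.* e) ℚ.- a ℚ.* e
    add-sub = solve-∀ ℚ-almostCommutativeRing
    0-a*0≡0 : ∀ a → 0ℚ ℚ.- a ℚ.* 0ℚ ≡ 0ℚ
    0-a*0≡0 = solve-∀ ℚ-almostCommutativeRing

-- Vanishing beyond a bound, unlike vanishing off a finite set, survives division by X − (b + 1).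
vanishing⇒zeros : ∀ n p b → length p ≡ n → (∀ x → b ℚ.< x → evalℚ x p ≡ 0ℚ) → All (_≡ 0ℚ) p
vanishing⇒zeros n       []      b _   _      = []
vanishing⇒zeros (suc n) (c ∷ q) b len vanish =
  zeros-quotientByX- a (c ∷ q)
    (vanishing⇒zeros n (quotientByX- a (c ∷ q)) a
      (≡.trans (length-quotientByX- a c q) (ℕ.suc-injective len)) quotient-vanish)
    (vanish a b<a)
  where
  a : ℚ
  a = b ℚ.+ 1ℚ
  b<a : b ℚ.< a
  b<a = ℚ.<-respˡ-≡ (ℚ.+-identityʳ b) (ℚ.+-monoʳ-< b (ℚ.positive⁻¹ 1ℚ))
  quotient-vanish : ∀ x → a ℚ.< x → evalℚ x (quotientByX- a (c ∷ q)) ≡ 0ℚ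
  quotient-vanish x a<x = ℚ-cancel x-a≢0 (begin
    (x ℚ.- a) ℚ.* evalℚ x (quotientByX- a (c ∷ q))
      ≡⟨ ℚ.+-identityˡ _ ⟨
    0ℚ ℚ.+ (x ℚ.- a) ℚ.* evalℚ x (quotientByX- a (c ∷ q))
      ≡⟨ ≡.cong (ℚ._+ ((x ℚ.- a) ℚ.* evalℚ x (quotientByX- a (c ∷ q)))) (vanish a b<a) ⟨
    evalℚ a (c ∷ q) ℚ.+ (x ℚ.- a) ℚ.* evalℚ x (quotientByX- a (c ∷ q))
      ≡⟨ evalℚ-quotientByX- x a (c ∷ q) ⟨
    evalℚ x (c ∷ q)
      ≡⟨ vanish x (ℚ.<-trans b<a a<x) ⟩
    0ℚ ∎)
    where
    open ≡.≡-Reasoning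
    x-a≢0 : x ℚ.- a ≢ 0ℚ
    x-a≢0 x-a≡0 = ℚ.<⇒≢ a<x (≡.sym (begin
      x                ≡⟨ sub-add x a ⟩
      (x ℚ.- a) ℚ.+ a  ≡⟨ ≡.cong (ℚ._+ a) x-a≡0 ⟩
      0ℚ ℚ.+ a         ≡⟨ ℚ.+-identityˡ a ⟩
      a                ∎))
      where
      sub-add : ∀ x a → x ≡ (x ℚ.- a) ℚ.+ a
      sub-add = solve-∀ ℚ-almostCommutativeRing

identityPrinciple : ∀ p → (∀ x → evalℚ x p ≡ 0ℚ) → All (_≡ 0ℚ) p
identityPrinciple p vanish = vanishing⇒zeros (length p) p 0ℚ ≡.refl (λ x _ → vanish x)

-- ℚ[X] up to equality of polynomial functions on ℚ, which by identityPrinciple is equality of coefficients.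
infix 4 _≈ₚ_
record _≈ₚ_ (p q : Pol) : Set where
  constructor mk≈ₚ
  field evalℚ-≡ : ∀ x → evalℚ x p ≡ evalℚ x q
open _≈ₚ_

ℚ[X]-rawRing : RawRing 0ℓ 0ℓ
ℚ[X]-rawRing = record
  { Carrier = Pol ; _≈_ = _≈ₚ_
  ; _+_ = _+ₚ_ ; _*_ = _*ₚ_ ; -_ = -ₚ_ ; 0# = [] ; 1# = 1ℚ ∷ [] }

ℚ^ℚ : CommutativeRing 0ℓ 0ℓ
ℚ^ℚ = Pointwise.commutativeRing ℚ ℚ.+-*-commutativeRing

polynomialFunction-isRingMonomorphism :
  IsRingMonomorphism ℚ[X]-rawRing (CommutativeRing.rawRing ℚ^ℚ) (λ p x → evalℚ x p)
polynomialFunction-isRingMonomorphism = record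
  { isRingHomomorphism = mkIsRingHomomorphism _ evalℚ-≡
      (λ p q x → evalℚ-+ x p q) (λ p q x → evalℚ-* x p q) (λ p x → evalℚ-neg x p) (λ _ → ≡.refl) evalℚ-1
  ; injective = mk≈ₚ }

ℚ[X] : CommutativeRing 0ℓ 0ℓ
ℚ[X] = record
  { Carrier = Pol ; _≈_ = _≈ₚ_
  ; _+_ = _+ₚ_ ; _*_ = _*ₚ_ ; -_ = -ₚ_ ; 0# = [] ; 1# = 1ℚ ∷ []
  ; isCommutativeRing = RingMonomorphism.isCommutativeRing polynomialFunction-isRingMonomorphism
                          (CommutativeRing.isCommutativeRing ℚ^ℚ) }

module _ {c ℓ} (A : ℚAlgebra c ℓ) (x : ℚAlgebra.Carrier A) where
  open ℚAlgebra A
  open Evaluation A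
  open import Algebra.Properties.Group +-group using (x∙y⁻¹≈ε⇒x≈y)

  eval-cong : ∀ {p q} → p ≈ₚ q → eval x p ≈ eval x q
  eval-cong {p} {q} (mk≈ₚ p≈q) = x∙y⁻¹≈ε⇒x≈y _ _ (begin
    eval x p + - eval x q     ≈⟨ +-congˡ (eval-neg x q) ⟨
    eval x p + eval x (-ₚ q)  ≈⟨ eval-+ x p (-ₚ q) ⟨
    eval x (p +ₚ -ₚ q)        ≈⟨ eval-zeros x (identityPrinciple (p +ₚ -ₚ q) difference-vanishes) ⟩
    0#                        ∎)
    where
    open import Relation.Binary.Reasoning.Setoid setoid
    difference-vanishes : ∀ y → evalℚ y (p +ₚ -ₚ q) ≡ 0ℚ
    difference-vanishes y = ≡.trans (evalℚ-+ y p (-ₚ q))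
      (≡.trans (≡.cong₂ ℚ._+_ (p≈q y) (evalℚ-neg y q)) (ℚ.+-inverseʳ (evalℚ y q)))

  eval-isRingHomomorphism : IsRingHomomorphism (CommutativeRing.rawRing ℚ[X]) rawRing (eval x)
  eval-isRingHomomorphism = mkIsRingHomomorphism (eval x) eval-cong (eval-+ x) (eval-* x) (eval-neg x) refl (eval-1 x)

  open RingHomomorphism {R₁ = CommutativeRing.ring ℚ[X]} {R₂ = ring} eval-isRingHomomorphism public
    using () renaming (∑-homo to eval-∑; product-homo to eval-product)

-- Rational roots of unity and Lucas sequences

∣^ℚ∣ : ∀ r k → ℚ.∣ r ^ℚ k ∣ ≡ ℚ.∣ r ∣ ^ℚ k
∣^ℚ∣ r zero    = ≡.refl
∣^ℚ∣ r (suc k) = ≡.trans (ℚ.∣p*q∣≡∣p∣*∣q∣ r (r ^ℚ k)) (≡.cong (ℚ.∣ r ∣ ℚ.*_) (∣^ℚ∣ r k))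

module _ (a : ℚ) .{{_ : ℚ.NonNegative a}} where

  ^ℚ-≤-base : a ℚ.≤ 1ℚ → ∀ k → a ^ℚ suc k ℚ.≤ a
  ^ℚ-≤-base a≤1 zero    = ℚ.≤-reflexive (ℚ.*-identityʳ a)
  ^ℚ-≤-base a≤1 (suc k) = ℚ.≤-trans (ℚ.*-monoˡ-≤-nonNeg a (^ℚ-≤-base a≤1 k))
                            (ℚ.≤-trans (ℚ.*-monoˡ-≤-nonNeg a a≤1) (ℚ.≤-reflexive (ℚ.*-identityʳ a)))

  ^ℚ-≥-base : 1ℚ ℚ.≤ a → ∀ k → a ℚ.≤ a ^ℚ suc k
  ^ℚ-≥-base 1≤a zero    = ℚ.≤-reflexive (≡.sym (ℚ.*-identityʳ a))
  ^ℚ-≥-base 1≤a (suc k) = ℚ.≤-trans (ℚ.≤-reflexive (≡.sym (ℚ.*-identityʳ a)))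
                            (ℚ.≤-trans (ℚ.*-monoˡ-≤-nonNeg a 1≤a) (ℚ.*-monoˡ-≤-nonNeg a (^ℚ-≥-base 1≤a k)))

rootOfUnity⇒±1 : ∀ r k → r ^ℚ suc k ≡ 1ℚ → r ≡ 1ℚ ⊎ r ≡ ℚ.- 1ℚ
rootOfUnity⇒±1 r k rᵏ⁺¹≡1 with ℚ.<-cmp ℚ.∣ r ∣ 1ℚ | ℚ.∣p∣≡p∨∣p∣≡-p r
... | tri< ∣r∣<1 _ _ | _ =
  ⊥-elim (ℚ.<-irrefl ∣r∣ᵏ⁺¹≡1 (ℚ.≤-<-trans (^ℚ-≤-base ℚ.∣ r ∣ {{ℚ.∣-∣-nonNeg r}} (ℚ.<⇒≤ ∣r∣<1) k) ∣r∣<1))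
  where
  ∣r∣ᵏ⁺¹≡1 : ℚ.∣ r ∣ ^ℚ suc k ≡ 1ℚ
  ∣r∣ᵏ⁺¹≡1 = ≡.trans (≡.sym (∣^ℚ∣ r (suc k))) (≡.cong ℚ.∣_∣ rᵏ⁺¹≡1)
... | tri> _ _ 1<∣r∣ | _ =
  ⊥-elim (ℚ.<-irrefl (≡.sym ∣r∣ᵏ⁺¹≡1) (ℚ.<-≤-trans 1<∣r∣ (^ℚ-≥-base ℚ.∣ r ∣ {{ℚ.∣-∣-nonNeg r}} (ℚ.<⇒≤ 1<∣r∣) k)))
  where
  ∣r∣ᵏ⁺¹≡1 : ℚ.∣ r ∣ ^ℚ suc k ≡ 1ℚ
  ∣r∣ᵏ⁺¹≡1 = ≡.trans (≡.sym (∣^ℚ∣ r (suc k))) (≡.cong ℚ.∣_∣ rᵏ⁺¹≡1)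
... | tri≈ _ ∣r∣≡1 _ | inj₁ ∣r∣≡r  = inj₁ (≡.trans (≡.sym ∣r∣≡r) ∣r∣≡1)
... | tri≈ _ ∣r∣≡1 _ | inj₂ ∣r∣≡-r = inj₂ (ℚ.neg-injective (≡.trans (≡.sym ∣r∣≡-r) ∣r∣≡1))

-- lucas c 0 1 is the Lucas sequence U_k(c, 1), i.e. the Chebyshev polynomial U_{k−1}(c/2).
lucas : ℚ → ℚ → ℚ → ℕ → ℚ
lucas c x₀ x₁ zero          = x₀
lucas c x₀ x₁ (suc zero)    = x₁
lucas c x₀ x₁ (suc (suc k)) = c ℚ.* lucas c x₀ x₁ (suc k) ℚ.- lucas c x₀ x₁ k

fromℤ : ℤ → ℚ
fromℤ z = z ℚ./ 1

private
  toℚᵘ-fromℤ : ∀ z → ℚ.toℚᵘ (fromℤ z) ℚᵘ.≃ mkℚᵘ z 0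
  toℚᵘ-fromℤ z = ℚ.toℚᵘ-fromℚᵘ (mkℚᵘ z 0)

  ≡-via-ℚᵘ : ∀ {x : ℚ} {e : ℚᵘ} → ℚ.toℚᵘ x ℚᵘ.≃ e → x ≡ ℚ.fromℚᵘ e
  ≡-via-ℚᵘ {x} x≃e = ≡.trans (≡.sym (ℚ.fromℚᵘ-toℚᵘ x)) (ℚ.fromℚᵘ-cong x≃e)

fromℤ-+ : ∀ a b → fromℤ (a ℤ.+ b) ≡ fromℤ a ℚ.+ fromℤ b
fromℤ-+ a b = ≡.sym (≡-via-ℚᵘ {e = mkℚᵘ (a ℤ.+ b) 0} (ℚᵘ.≃-trans (ℚ.toℚᵘ-homo-+ (fromℤ a) (fromℤ b))
  (ℚᵘ.≃-trans (ℚᵘ.+-cong (toℚᵘ-fromℤ a) (toℚᵘ-fromℤ b))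
    (*≡* (≡.trans (ℤ.*-identityʳ _)
           (≡.trans (≡.cong₂ ℤ._+_ (ℤ.*-identityʳ a) (ℤ.*-identityʳ b)) (≡.sym (ℤ.*-identityʳ _))))))))

fromℤ-* : ∀ a b → fromℤ (a ℤ.* b) ≡ fromℤ a ℚ.* fromℤ b
fromℤ-* a b = ≡.sym (≡-via-ℚᵘ {e = mkℚᵘ (a ℤ.* b) 0} (ℚᵘ.≃-trans (ℚ.toℚᵘ-homo-* (fromℤ a) (fromℤ b))
  (ℚᵘ.≃-trans (ℚᵘ.*-cong (toℚᵘ-fromℤ a) (toℚᵘ-fromℤ b)) (*≡* ≡.refl))))

fromℤ-neg : ∀ a → fromℤ (ℤ.- a) ≡ ℚ.- fromℤ a
fromℤ-neg a = ≡.sym (≡-via-ℚᵘ {e = mkℚᵘ (ℤ.- a) 0} (ℚᵘ.≃-trans (ℚ.toℚᵘ-homo‿- (fromℤ a))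
  (ℚᵘ.≃-trans (ℚᵘ.-‿cong (toℚᵘ-fromℤ a)) (*≡* ≡.refl))))

fromℤ-- : ∀ a b → fromℤ (a ℤ.- b) ≡ fromℤ a ℚ.- fromℤ b
fromℤ-- a b = ≡.trans (fromℤ-+ a (ℤ.- b)) (≡.cong (fromℤ a ℚ.+_) (fromℤ-neg b))

fromℤ-injective-0 : ∀ z → fromℤ z ≡ 0ℚ → z ≡ ℤ.0ℤ
fromℤ-injective-0 z z≡0 = ≡.trans (≡.sym (ℚ.↥-/ z 1))
  (≡.trans (≡.cong (λ q → ↥ q ℤ.* ℤ.gcd z (+ 1)) z≡0) (ℤ.*-zeroˡ (ℤ.gcd z (+ 1))))

∣^∣ : ∀ z k → ℤ.∣ z ℤ.^ k ∣ ≡ ℤ.∣ z ∣ ℕ.^ k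
∣^∣ z zero    = ≡.refl
∣^∣ z (suc k) = ≡.trans (ℤ.∣i*j∣≡∣i∣*∣j∣ z (z ℤ.^ k)) (≡.cong (ℤ.∣ z ∣ ℕ.*_) (∣^∣ z k))

coprime-∣^⇒∣1 : ∀ {d m} k → Coprime d m → d ∣ m ℕ.^ k → d ∣ 1
coprime-∣^⇒∣1 zero    cop d∣mᵏ = d∣mᵏ
coprime-∣^⇒∣1 (suc k) cop d∣mᵏ = coprime-∣^⇒∣1 k cop (coprime-divisor cop d∣mᵏ)

-- For c = n / d, the numbers d^(k-1) U_k(c) are the integers B k below.
module ScaledLucas (n : ℤ) (d : ℕ) where

  B : ℕ → ℤ
  B zero          = + 0
  B (suc zero)    = + 1
  B (suc (suc k)) = n ℤ.* B (suc k) ℤ.- (+ d ℤ.* + d) ℤ.* B k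

  B≡n^k-mod-d : ∀ k → ∃ λ t → B (suc k) ℤ.- n ℤ.^ k ≡ + d ℤ.* t
  B≡n^k-mod-d zero    = + 0 , ≡.trans (ℤ.+-inverseʳ (+ 1)) (≡.sym (ℤ.*-zeroʳ (+ d)))
  B≡n^k-mod-d (suc k) with B≡n^k-mod-d k
  ... | t , eq = n ℤ.* t ℤ.- + d ℤ.* B k , (begin
    (n ℤ.* B (suc k) ℤ.- (+ d ℤ.* + d) ℤ.* B k) ℤ.- n ℤ.* n ℤ.^ k ≡⟨ regroup n (B (suc k)) (B k) (+ d) (n ℤ.^ k) ⟩
    n ℤ.* (B (suc k) ℤ.- n ℤ.^ k) ℤ.- + d ℤ.* (+ d ℤ.* B k)     ≡⟨ ≡.cong (λ z → n ℤ.* z ℤ.- + d ℤ.* (+ d ℤ.* B k)) eq ⟩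
    n ℤ.* (+ d ℤ.* t) ℤ.- + d ℤ.* (+ d ℤ.* B k)                 ≡⟨ factor n (+ d) t (B k) ⟩
    + d ℤ.* (n ℤ.* t ℤ.- + d ℤ.* B k)                           ∎)
    where
    open ≡.≡-Reasoning
    regroup : ∀ n b₁ b₀ d p → (n ℤ.* b₁ ℤ.- (d ℤ.* d) ℤ.* b₀) ℤ.- n ℤ.* p ≡ n ℤ.* (b₁ ℤ.- p) ℤ.- d ℤ.* (d ℤ.* b₀)
    regroup = ℤ-Solver.solve-∀
    factor : ∀ n d t b → n ℤ.* (d ℤ.* t) ℤ.- d ℤ.* (d ℤ.* b) ≡ d ℤ.* (n ℤ.* t ℤ.- d ℤ.* b)
    factor = ℤ-Solver.solve-∀

  B-recurrence : ∀ k → n ℤ.* B (suc k) ≡ B (suc (suc k)) ℤ.+ (+ d ℤ.* + d) ℤ.* B k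
  B-recurrence k = sub-add (n ℤ.* B (suc k)) ((+ d ℤ.* + d) ℤ.* B k)
    where
    sub-add : ∀ x y → x ≡ (x ℤ.- y) ℤ.+ y
    sub-add = ℤ-Solver.solve-∀

  module _ (d≡1 : d ≡ 1) (2≤∣n∣ : 2 ℕ.≤ ℤ.∣ n ∣) where

    ∣B∣-increasing : ∀ k → ℤ.∣ B k ∣ ℕ.+ 1 ℕ.≤ ℤ.∣ B (suc k) ∣
    ∣B∣-increasing zero    = s≤s z≤n
    ∣B∣-increasing (suc k) = ℕ.+-cancelʳ-≤ b₀ (b₁ ℕ.+ 1) b₂ (begin
      (b₁ ℕ.+ 1) ℕ.+ b₀                                ≡⟨ ℕ.+-assoc b₁ 1 b₀ ⟩
      b₁ ℕ.+ (1 ℕ.+ b₀)                                ≡⟨ ≡.cong (b₁ ℕ.+_) (ℕ.+-comm 1 b₀) ⟩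
      b₁ ℕ.+ (b₀ ℕ.+ 1)                                ≤⟨ ℕ.+-monoʳ-≤ b₁ (∣B∣-increasing k) ⟩
      b₁ ℕ.+ b₁                                        ≡⟨ ≡.cong (b₁ ℕ.+_) (ℕ.+-identityʳ b₁) ⟨
      2 ℕ.* b₁                                         ≤⟨ ℕ.*-monoˡ-≤ b₁ 2≤∣n∣ ⟩
      ℤ.∣ n ∣ ℕ.* b₁                                   ≡⟨ ℤ.∣i*j∣≡∣i∣*∣j∣ n (B (suc k)) ⟨
      ℤ.∣ n ℤ.* B (suc k) ∣                            ≡⟨ ≡.cong ℤ.∣_∣ (B-recurrence k) ⟩
      ℤ.∣ B (suc (suc k)) ℤ.+ (+ d ℤ.* + d) ℤ.* B k ∣  ≤⟨ ℤ.∣i+j∣≤∣i∣+∣j∣ (B (suc (suc k))) _ ⟩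
      b₂ ℕ.+ ℤ.∣ (+ d ℤ.* + d) ℤ.* B k ∣               ≡⟨ ≡.cong (λ e → b₂ ℕ.+ ℤ.∣ (+ e ℤ.* + e) ℤ.* B k ∣) d≡1 ⟩
      b₂ ℕ.+ ℤ.∣ (+ 1 ℤ.* + 1) ℤ.* B k ∣               ≡⟨ ≡.cong (λ z → b₂ ℕ.+ ℤ.∣ z ∣) (ℤ.*-identityˡ (B k)) ⟩
      b₂ ℕ.+ b₀                                        ∎)
      where
      open ℕ.≤-Reasoning
      b₀ b₁ b₂ : ℕ
      b₀ = ℤ.∣ B k ∣
      b₁ = ℤ.∣ B (suc k) ∣
      b₂ = ℤ.∣ B (suc (suc k)) ∣

    B≢0 : ∀ k → B (suc k) ≢ + 0
    B≢0 k B≡0 = ℕ.≤⇒≯ (≡.subst (λ z → ℤ.∣ B k ∣ ℕ.+ 1 ℕ.≤ ℤ.∣ z ∣) B≡0 (∣B∣-increasing k)) (ℕ.m≤n+m 1 (ℤ.∣ B k ∣))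

module _ (n : ℤ) (d-1 : ℕ) .(cop : Coprime ℤ.∣ n ∣ (suc d-1)) where
  open ScaledLucas n (suc d-1)
  private
    d : ℕ
    d = suc d-1
    c D : ℚ
    c = mkℚ n d-1 cop
    D = fromℤ (+ d)

  c*D≡n : c ℚ.* D ≡ fromℤ n
  c*D≡n = ≡-via-ℚᵘ {e = mkℚᵘ n 0} (ℚᵘ.≃-trans (ℚ.toℚᵘ-homo-* c D)
    (ℚᵘ.≃-trans (ℚᵘ.*-cong (ℚᵘ.≃-refl {mkℚᵘ n d-1}) (toℚᵘ-fromℤ (+ d)))
      (*≡* (≡.trans (ℤ.*-identityʳ (n ℤ.* + d)) (≡.cong (λ z → n ℤ.* + z) (≡.sym (ℕ.*-identityʳ d)))))))

  lucas-scaled : ∀ k → (lucas c 0ℚ 1ℚ k ℚ.* D ^ℚ k ≡ fromℤ (B k) ℚ.* D)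
                     × (lucas c 0ℚ 1ℚ (suc k) ℚ.* D ^ℚ suc k ≡ fromℤ (B (suc k)) ℚ.* D)
  lucas-scaled zero    = ≡.trans (ℚ.*-zeroˡ 1ℚ) (≡.sym (ℚ.*-zeroˡ D)) , ≡.cong (1ℚ ℚ.*_) (ℚ.*-identityʳ D)
  lucas-scaled (suc k) = proj₂ (lucas-scaled k) , (begin
    (c ℚ.* u₁ ℚ.- u₀) ℚ.* (D ℚ.* (D ℚ.* Dᵏ))
      ≡⟨ expand c u₁ u₀ D Dᵏ ⟩
    (c ℚ.* D) ℚ.* (u₁ ℚ.* (D ℚ.* Dᵏ)) ℚ.- (D ℚ.* D) ℚ.* (u₀ ℚ.* Dᵏ)
      ≡⟨ ≡.cong₂ (λ x y → x ℚ.- (D ℚ.* D) ℚ.* y)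
                 (≡.cong₂ ℚ._*_ c*D≡n (proj₂ (lucas-scaled k))) (proj₁ (lucas-scaled k)) ⟩
    fromℤ n ℚ.* (fromℤ (B (suc k)) ℚ.* D) ℚ.- (D ℚ.* D) ℚ.* (fromℤ (B k) ℚ.* D)
      ≡⟨ collect (fromℤ n) (fromℤ (B (suc k))) (fromℤ (B k)) D ⟩
    (fromℤ n ℚ.* fromℤ (B (suc k)) ℚ.- (D ℚ.* D) ℚ.* fromℤ (B k)) ℚ.* D
      ≡⟨ ≡.cong (ℚ._* D) fromℤ-recurrence ⟨
    fromℤ (B (suc (suc k))) ℚ.* D ∎)
    where
    open ≡.≡-Reasoning
    u₁ u₀ Dᵏ : ℚ
    u₁ = lucas c 0ℚ 1ℚ (suc k)
    u₀ = lucas c 0ℚ 1ℚ k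
    Dᵏ = D ^ℚ k
    expand : ∀ c u₁ u₀ D Dᵏ → (c ℚ.* u₁ ℚ.- u₀) ℚ.* (D ℚ.* (D ℚ.* Dᵏ))
                            ≡ (c ℚ.* D) ℚ.* (u₁ ℚ.* (D ℚ.* Dᵏ)) ℚ.- (D ℚ.* D) ℚ.* (u₀ ℚ.* Dᵏ)
    expand = solve-∀ ℚ-almostCommutativeRing
    collect : ∀ a b₁ b₀ D → a ℚ.* (b₁ ℚ.* D) ℚ.- (D ℚ.* D) ℚ.* (b₀ ℚ.* D) ≡ (a ℚ.* b₁ ℚ.- (D ℚ.* D) ℚ.* b₀) ℚ.* D
    collect = solve-∀ ℚ-almostCommutativeRing
    fromℤ-recurrence : fromℤ (B (suc (suc k))) ≡ fromℤ n ℚ.* fromℤ (B (suc k)) ℚ.- (D ℚ.* D) ℚ.* fromℤ (B k)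
    fromℤ-recurrence = ≡.trans (fromℤ-- (n ℤ.* B (suc k)) _)
      (≡.cong₂ ℚ._-_ (fromℤ-* n (B (suc k)))
                     (≡.trans (fromℤ-* (+ d ℤ.* + d) (B k)) (≡.cong (ℚ._* fromℤ (B k)) (fromℤ-* (+ d) (+ d)))))

  lucas≡0⇒B≡0 : ∀ k → lucas c 0ℚ 1ℚ (suc k) ≡ 0ℚ → B (suc k) ≡ + 0
  lucas≡0⇒B≡0 k uₖ≡0 = fromℤ-injective-0 _ (ℚ-cancel D≢0 (begin
    D ℚ.* fromℤ (B (suc k))               ≡⟨ ℚ.*-comm D _ ⟩
    fromℤ (B (suc k)) ℚ.* D               ≡⟨ proj₂ (lucas-scaled k) ⟨
    lucas c 0ℚ 1ℚ (suc k) ℚ.* D ^ℚ suc k  ≡⟨ ≡.cong (ℚ._* D ^ℚ suc k) uₖ≡0 ⟩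
    0ℚ ℚ.* D ^ℚ suc k                     ≡⟨ ℚ.*-zeroˡ (D ^ℚ suc k) ⟩
    0ℚ                                    ∎))
    where
    open ≡.≡-Reasoning
    D≢0 : D ≢ 0ℚ
    D≢0 D≡0 with fromℤ-injective-0 (+ d) D≡0
    ... | ()

-- With c = 2cos θ, U_k(c) = sin kθ / sin θ: this is the rationality fact behind the
-- crystallographic restriction. Write c = n/d; for d > 1, d^(k−1) U_k(c) ≡ n^(k−1) (mod d),
-- and for d = 1, |n| ≥ 2 makes |U_k(c)| strictly increasing.
lucasU-nonzero : ∀ c → c ≢ 0ℚ → c ≢ 1ℚ → c ≢ ℚ.- 1ℚ → ∀ k → lucas c 0ℚ 1ℚ (suc k) ≢ 0ℚ
lucasU-nonzero (mkℚ n (suc d-2) cop) _ _ _ k uₖ≡0 =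
  d≢1 (∣1⇒≡1 (coprime-∣^⇒∣1 k (Coprimality.sym (Coprimality.recompute cop)) (divides ℤ.∣ t ∣ ∣n∣ᵏ≡∣t∣d)))
  where
  d : ℕ
  d = suc (suc d-2)
  open ScaledLucas n d
  d≢1 : d ≢ 1
  d≢1 ()
  t : ℤ
  t = proj₁ (B≡n^k-mod-d k)
  ∣n∣ᵏ≡∣t∣d : ℤ.∣ n ∣ ℕ.^ k ≡ ℤ.∣ t ∣ ℕ.* d
  ∣n∣ᵏ≡∣t∣d = begin
    ℤ.∣ n ∣ ℕ.^ k                ≡⟨ ∣^∣ n k ⟨
    ℤ.∣ n ℤ.^ k ∣                ≡⟨ ℤ.∣-i∣≡∣i∣ (n ℤ.^ k) ⟨
    ℤ.∣ ℤ.- n ℤ.^ k ∣            ≡⟨ ≡.cong ℤ.∣_∣ (ℤ.+-identityˡ (ℤ.- n ℤ.^ k)) ⟨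
    ℤ.∣ + 0 ℤ.- n ℤ.^ k ∣        ≡⟨ ≡.cong (λ z → ℤ.∣ z ℤ.- n ℤ.^ k ∣) (lucas≡0⇒B≡0 n (suc d-2) cop k uₖ≡0) ⟨
    ℤ.∣ B (suc k) ℤ.- n ℤ.^ k ∣  ≡⟨ ≡.cong ℤ.∣_∣ (proj₂ (B≡n^k-mod-d k)) ⟩
    ℤ.∣ + d ℤ.* t ∣              ≡⟨ ℤ.∣i*j∣≡∣i∣*∣j∣ (+ d) t ⟩
    d ℕ.* ℤ.∣ t ∣                ≡⟨ ℕ.*-comm d ℤ.∣ t ∣ ⟩
    ℤ.∣ t ∣ ℕ.* d                ∎
    where open ≡.≡-Reasoning
lucasU-nonzero (mkℚ +0 zero _) c≢0 _ _ _ _ = c≢0 ≡.refl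
lucasU-nonzero (mkℚ +[1+ zero ] zero _) _ c≢1 _ _ _ = c≢1 ≡.refl
lucasU-nonzero (mkℚ -[1+ zero ] zero _) _ _ c≢-1 _ _ = c≢-1 ≡.refl
lucasU-nonzero (mkℚ n@(+[1+ suc m ]) zero cop) _ _ _ k uₖ≡0 =
  ScaledLucas.B≢0 n 1 ≡.refl (s≤s (s≤s z≤n)) k (lucas≡0⇒B≡0 n zero cop k uₖ≡0)
lucasU-nonzero (mkℚ n@(-[1+ suc m ]) zero cop) _ _ _ k uₖ≡0 =
  ScaledLucas.B≢0 n 1 ≡.refl (s≤s (s≤s z≤n)) k (lucas≡0⇒B≡0 n zero cop k uₖ≡0)

-- Elements of finite order in ℚ-algebras

module ℚAlgebraPowers {c ℓ} (A : ℚAlgebra c ℓ) where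
  open ℚAlgebra A hiding (zero)
  open ℚAlgebraProperties A
  open RingSums ring using (product; product-commutes)
  open SemiringPowers semiring using (1#^k≈1#; commutes-^)
  open import Algebra.Properties.Semiring.Exp semiring using (_^_; ^-assocʳ; ^-congˡ)
  open import Algebra.Properties.Ring ring using (x[y-z]≈xy-xz)
  open import Algebra.Properties.Group +-group using (x∙y⁻¹≈ε⇒x≈y; ∙-cancelʳ)
  open import Relation.Binary.Reasoning.Setoid setoid

  -- If x fixes y = xV − V then xᵏV = V + k·y; a finite order of x forces y = 0 in characteristic 0.
  module _ (x V : Carrier) (fixes : x * (x * V - V) ≈ x * V - V) where
    private
      y : Carrier
      y = x * V - V

    ^-unipotent : ∀ k → x ^ k * V ≈ ι (fromℤ (+ k)) * y + V
    ^-unipotent zero    = trans (*-identityˡ V) (sym (trans (+-congʳ (trans (*-congʳ ι-0) (zeroˡ y))) (+-identityˡ V)))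
    ^-unipotent (suc k) = begin
      (x * x ^ k) * V
        ≈⟨ *-assoc _ _ _ ⟩
      x * (x ^ k * V)
        ≈⟨ *-congˡ (^-unipotent k) ⟩
      x * (ι (fromℤ (+ k)) * y + V)
        ≈⟨ distribˡ _ _ _ ⟩
      x * (ι (fromℤ (+ k)) * y) + x * V
        ≈⟨ +-cong (trans (ι-pull _ x y) (*-congˡ fixes)) xV≈y+V ⟩
      ι (fromℤ (+ k)) * y + (y + V)
        ≈⟨ +-assoc _ _ _ ⟨
      (ι (fromℤ (+ k)) * y + y) + V
        ≈⟨ +-congʳ (trans (+-comm _ _) (+-congʳ (sym (trans (*-congʳ ι-1) (*-identityˡ y))))) ⟩
      (ι 1ℚ * y + ι (fromℤ (+ k)) * y) + V
        ≈⟨ +-congʳ (trans (sym (distribʳ _ _ _)) (*-congʳ (sym (ι-+ _ _)))) ⟩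
      ι (1ℚ ℚ.+ fromℤ (+ k)) * y + V
        ≈⟨ +-congʳ (*-congʳ (reflexive (≡.cong ι (fromℤ-+ (+ 1) (+ k))))) ⟨
      ι (fromℤ (+ suc k)) * y + V ∎
      where
      xV≈y+V : x * V ≈ y + V
      xV≈y+V = sym (trans (+-assoc _ _ _) (trans (+-congˡ (-‿inverseˡ V)) (+-identityʳ _)))

    unipotent-fixed : ∀ {τ} → 1 ≤ τ → x ^ τ ≈ 1# → x * V ≈ V
    unipotent-fixed {suc τ-1} _ xᵗ≈1 = x∙y⁻¹≈ε⇒x≈y _ _ (ι-cancel τ≢0 (∙-cancelʳ V _ _ (begin
      ι (fromℤ (+ suc τ-1)) * y + V  ≈⟨ ^-unipotent (suc τ-1) ⟨
      x ^ suc τ-1 * V                ≈⟨ trans (*-congʳ xᵗ≈1) (*-identityˡ V) ⟩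
      V                              ≈⟨ +-identityˡ V ⟨
      0# + V                         ∎)))
      where
      τ≢0 : fromℤ (+ suc τ-1) ≢ 0ℚ
      τ≢0 τ≡0 with fromℤ-injective-0 (+ suc τ-1) τ≡0
      ... | ()

  module FiniteOrder (U : Carrier) {τ : ℕ} (1≤τ : 1 ≤ τ) (Uᵗ≈1 : U ^ τ ≈ 1#) where

    KerFixed : ℕ → Carrier → Set (c ⊔ ℓ)
    KerFixed m F = ∀ V → F * V ≈ 0# → U ^ m * V ≈ V

    kerFixed-1# : ∀ m → KerFixed m 1#
    kerFixed-1# m V 1V≈0 = trans (*-congˡ V≈0) (trans (zeroʳ _) (sym V≈0))
      where
      V≈0 : V ≈ 0#
      V≈0 = trans (sym (*-identityˡ V)) 1V≈0

    kerFixed-* : ∀ m {F G} → KerFixed m F → KerFixed m G → G * U ≈ U * G → KerFixed m (F * G)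
    kerFixed-* m {F} {G} kerF kerG GU≈UG V FGV≈0 =
      unipotent-fixed (U ^ m) V (kerG (U ^ m * V - V) G-kills) 1≤τ Uᵐ-finiteOrder
      where
      GV-fixed : U ^ m * (G * V) ≈ G * V
      GV-fixed = kerF (G * V) (trans (sym (*-assoc _ _ _)) FGV≈0)
      G-kills : G * (U ^ m * V - V) ≈ 0#
      G-kills = begin
        G * (U ^ m * V - V)      ≈⟨ x[y-z]≈xy-xz G _ V ⟩
        G * (U ^ m * V) - G * V  ≈⟨ +-congʳ (*-assoc _ _ _) ⟨
        (G * U ^ m) * V - G * V  ≈⟨ +-congʳ (*-congʳ (commutes-^ m GU≈UG)) ⟩
        (U ^ m * G) * V - G * V  ≈⟨ +-congʳ (trans (*-assoc _ _ _) GV-fixed) ⟩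
        G * V - G * V            ≈⟨ -‿inverseʳ (G * V) ⟩
        0#                       ∎
      Uᵐ-finiteOrder : (U ^ m) ^ τ ≈ 1#
      Uᵐ-finiteOrder = begin
        (U ^ m) ^ τ    ≈⟨ ^-assocʳ U m τ ⟩
        U ^ (m ℕ.* τ)  ≡⟨ ≡.cong (U ^_) (ℕ.*-comm m τ) ⟩
        U ^ (τ ℕ.* m)  ≈⟨ ^-assocʳ U τ m ⟨
        (U ^ τ) ^ m    ≈⟨ trans (^-congˡ m Uᵗ≈1) (1#^k≈1# m) ⟩
        1#             ∎

    kerFixed-product : ∀ m {k} (f : Fin k → Carrier) → (∀ i → KerFixed m (f i)) → (∀ i → f i * U ≈ U * f i) →
                       KerFixed m (product f)
    kerFixed-product m {zero}  f _   _       = kerFixed-1# m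
    kerFixed-product m {suc k} f ker commute =
      kerFixed-* m (ker zero) (kerFixed-product m (f ∘ suc) (ker ∘ suc) (commute ∘ suc))
                 (product-commutes (f ∘ suc) U (commute ∘ suc))

    eigenvector-powers : ∀ {r V} → U * V ≈ ι r * V → ∀ k → U ^ k * V ≈ ι (r ^ℚ k) * V
    eigenvector-powers {r} {V} UV≈rV zero    = sym (trans (*-congʳ ι-1) refl)
    eigenvector-powers {r} {V} UV≈rV (suc k) = begin
      (U * U ^ k) * V         ≈⟨ *-assoc _ _ _ ⟩
      U * (U ^ k * V)         ≈⟨ *-congˡ (eigenvector-powers UV≈rV k) ⟩
      U * (ι (r ^ℚ k) * V)    ≈⟨ ι-pull _ U V ⟩
      ι (r ^ℚ k) * (U * V)    ≈⟨ *-congˡ UV≈rV ⟩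
      ι (r ^ℚ k) * (ι r * V)  ≈⟨ ι-*-assoc _ _ V ⟩
      ι (r ^ℚ k ℚ.* r) * V    ≈⟨ *-congʳ (reflexive (≡.cong ι (ℚ.*-comm (r ^ℚ k) r))) ⟩
      ι (r ^ℚ suc k) * V      ∎

    eigenvector-fixed : ∀ r V → U * V ≈ ι r * V → U ^ 12 * V ≈ V
    eigenvector-fixed r V UV≈rV with r ^ℚ τ ℚ.≟ 1ℚ
    ... | yes rᵗ≡1 = begin
      U ^ 12 * V       ≈⟨ eigenvector-powers UV≈rV 12 ⟩
      ι (r ^ℚ 12) * V  ≈⟨ *-congʳ (reflexive (≡.cong ι (r¹²≡1 (rootOfUnity⇒±1 r (ℕ.pred τ) rᵗ≡1′)))) ⟩
      ι 1ℚ * V         ≈⟨ trans (*-congʳ ι-1) (*-identityˡ V) ⟩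
      V                ∎
      where
      rᵗ≡1′ : r ^ℚ suc (ℕ.pred τ) ≡ 1ℚ
      rᵗ≡1′ = ≡.subst (λ t → r ^ℚ t ≡ 1ℚ) (≡.sym (ℕ.suc-pred τ {{ℕ.>-nonZero 1≤τ}})) rᵗ≡1
      r¹²≡1 : r ≡ 1ℚ ⊎ r ≡ ℚ.- 1ℚ → r ^ℚ 12 ≡ 1ℚ
      r¹²≡1 (inj₁ r≡1)  = ≡.cong (_^ℚ 12) r≡1
      r¹²≡1 (inj₂ r≡-1) = ≡.cong (_^ℚ 12) r≡-1
    ... | no rᵗ≢1 = trans (*-congˡ V≈0) (trans (zeroʳ _) (sym V≈0))
      where
      rᵗ-1≢0 : r ^ℚ τ ℚ.- 1ℚ ≢ 0ℚ
      rᵗ-1≢0 eq = rᵗ≢1 (ℚ-Group.x∙y⁻¹≈ε⇒x≈y _ _ eq)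
      V≈0 : V ≈ 0#
      V≈0 = ι-cancel rᵗ-1≢0 (begin
        ι (r ^ℚ τ ℚ.- 1ℚ) * V            ≈⟨ trans (*-congʳ (ι-+ _ _)) (distribʳ _ _ _) ⟩
        ι (r ^ℚ τ) * V + ι (ℚ.- 1ℚ) * V  ≈⟨ +-cong (sym (eigenvector-powers UV≈rV τ)) (ι-neg1* V) ⟩
        U ^ τ * V - V                    ≈⟨ +-congʳ (trans (*-congʳ Uᵗ≈1) (*-identityˡ V)) ⟩
        V - V                            ≈⟨ -‿inverseʳ V ⟩
        0#                               ∎)

    module _ (a : ℚ) (V : Carrier) (recurrence : U * (U * V) ≈ ι a * (U * V) - V) where
      private
        u : ℕ → Carrier
        u k = U ^ k * V

        shift : ∀ k X → U ^ k * (U * X) ≈ U * (U ^ k * X)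
        shift k X = trans (sym (*-assoc _ _ _)) (trans (*-congʳ (sym (commutes-^ k refl))) (*-assoc _ _ _))

        u-recurrence : ∀ k → u (suc (suc k)) ≈ ι a * u (suc k) - u k
        u-recurrence k = begin
          (U * (U * U ^ k)) * V
            ≈⟨ trans (*-assoc _ _ _) (*-congˡ (*-assoc _ _ _)) ⟩
          U * (U * u k)
            ≈⟨ trans (*-congˡ (sym (shift k V))) (sym (shift k (U * V))) ⟩
          U ^ k * (U * (U * V))
            ≈⟨ *-congˡ recurrence ⟩
          U ^ k * (ι a * (U * V) - V)
            ≈⟨ x[y-z]≈xy-xz _ _ _ ⟩
          U ^ k * (ι a * (U * V)) - u k
            ≈⟨ +-congʳ (trans (ι-pull a _ _) (*-congˡ (trans (shift k V) (sym (*-assoc _ _ _))))) ⟩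
          ι a * u (suc k) - u k ∎

        u-lucas : ∀ k → (u k ≈ ι (lucas a 0ℚ 1ℚ k) * u 1 + ι (lucas a 1ℚ 0ℚ k) * u 0)
                      × (u (suc k) ≈ ι (lucas a 0ℚ 1ℚ (suc k)) * u 1 + ι (lucas a 1ℚ 0ℚ (suc k)) * u 0)
        u-lucas zero    = sym (trans (+-cong (ι0*x (u 1)) (ι1*x (u 0))) (+-identityˡ _))
                        , sym (trans (+-cong (ι1*x (u 1)) (ι0*x (u 0))) (+-identityʳ _))
          where
          ι0*x : ∀ x → ι 0ℚ * x ≈ 0#
          ι0*x x = trans (*-congʳ ι-0) (zeroˡ x)
          ι1*x : ∀ x → ι 1ℚ * x ≈ x
          ι1*x x = trans (*-congʳ ι-1) (*-identityˡ x)
        u-lucas (suc k) = proj₂ (u-lucas k) , trans (u-recurrence k)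
          (trans (+-cong (*-congˡ (proj₂ (u-lucas k))) (-‿cong (proj₁ (u-lucas k))))
                 (ι-linearStep a _ _ _ _ (u 1) (u 0)))

      -- For a ∈ {0, 1, −1} the sequence Uᵏ V has period 4, 6 or 3.
      fixed-by-periodicity : ∀ {b} → a ≡ b → lucas b 0ℚ 1ℚ 12 ≡ 0ℚ → lucas b 1ℚ 0ℚ 12 ≡ 1ℚ → U ^ 12 * V ≈ V
      fixed-by-periodicity ≡.refl p≡0 q≡1 = begin
        U ^ 12 * V
          ≈⟨ proj₁ (u-lucas 12) ⟩
        ι (lucas a 0ℚ 1ℚ 12) * u 1 + ι (lucas a 1ℚ 0ℚ 12) * u 0
          ≈⟨ +-cong (*-congʳ (ι≈ p≡0)) (*-congʳ (ι≈ q≡1)) ⟩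
        ι 0ℚ * u 1 + ι 1ℚ * u 0
          ≈⟨ +-cong (trans (*-congʳ ι-0) (zeroˡ _)) (trans (*-congʳ ι-1) (*-identityˡ _)) ⟩
        0# + 1# * V
          ≈⟨ trans (+-identityˡ _) (*-identityˡ V) ⟩
        V ∎
        where
        ι≈ : ∀ {x y} → x ≡ y → ι x ≈ ι y
        ι≈ = reflexive ∘ ≡.cong ι

      eigenvector-if-lucasU≢0 : lucas a 0ℚ 1ℚ τ ≢ 0ℚ → ∃ λ r → U * V ≈ ι r * V
      eigenvector-if-lucasU≢0 p≢0 = p⁻¹ ℚ.* (1ℚ ℚ.- q) , (begin
        U * V                         ≈⟨ *-congʳ (*-identityʳ U) ⟨
        u 1                           ≈⟨ trans (*-congʳ ι-1) (*-identityˡ (u 1)) ⟨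
        ι 1ℚ * u 1                    ≈⟨ *-congʳ (reflexive (≡.cong ι (ℚ.*-inverseˡ p))) ⟨
        ι (p⁻¹ ℚ.* p) * u 1           ≈⟨ ι-*-assoc p⁻¹ p (u 1) ⟨
        ι p⁻¹ * (ι p * u 1)           ≈⟨ *-congˡ p-relation ⟩
        ι p⁻¹ * (ι (1ℚ ℚ.- q) * u 0)  ≈⟨ ι-*-assoc p⁻¹ (1ℚ ℚ.- q) (u 0) ⟩
        ι (p⁻¹ ℚ.* (1ℚ ℚ.- q)) * u 0  ≈⟨ *-congˡ (*-identityˡ V) ⟩
        ι (p⁻¹ ℚ.* (1ℚ ℚ.- q)) * V    ∎)
        where
        p q p⁻¹ : ℚ
        p = lucas a 0ℚ 1ℚ τ
        q = lucas a 1ℚ 0ℚ τ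
        instance
          p≢0′ : ℚ.NonZero p
          p≢0′ = ℚ.≢-nonZero p≢0
        p⁻¹ = ℚ.1/ p
        p-relation : ι p * u 1 ≈ ι (1ℚ ℚ.- q) * u 0
        p-relation = begin
          ι p * u 1
            ≈⟨ trans (+-assoc _ _ _) (trans (+-congˡ (-‿inverseʳ _)) (+-identityʳ _)) ⟨
          (ι p * u 1 + ι q * u 0) - ι q * u 0
            ≈⟨ +-congʳ (proj₁ (u-lucas τ)) ⟨
          u τ - ι q * u 0
            ≈⟨ +-congʳ (trans (*-congʳ Uᵗ≈1) (sym (trans (*-congʳ ι-1) (*-identityˡ _)))) ⟩
          ι 1ℚ * u 0 - ι q * u 0
            ≈⟨ ι-*-sub 1ℚ q (u 0) ⟩
          ι (1ℚ ℚ.- q) * u 0 ∎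

      quadratic-fixed : U ^ 12 * V ≈ V
      quadratic-fixed with a ℚ.≟ 0ℚ | a ℚ.≟ 1ℚ | a ℚ.≟ ℚ.- 1ℚ
      ... | yes a≡0 | _       | _        = fixed-by-periodicity a≡0 ≡.refl ≡.refl
      ... | no _    | yes a≡1 | _        = fixed-by-periodicity a≡1 ≡.refl ≡.refl
      ... | no _    | no _    | yes a≡-1 = fixed-by-periodicity a≡-1 ≡.refl ≡.refl
      ... | no a≢0  | no a≢1  | no a≢-1  = eigenvector-fixed _ V (proj₂ (eigenvector-if-lucasU≢0 pᵗ≢0))
        where
        pᵗ≢0 : lucas a 0ℚ 1ℚ τ ≢ 0ℚ
        pᵗ≢0 = ≡.subst (λ t → lucas a 0ℚ 1ℚ t ≢ 0ℚ) (ℕ.suc-pred τ {{ℕ.>-nonZero 1≤τ}})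
                       (lucasU-nonzero a a≢0 a≢1 a≢-1 (ℕ.pred τ))

-- Two idempotents

two four : ℚ
two  = 1ℚ ℚ.+ 1ℚ
four = two ℚ.+ two

module Reflection {c ℓ} (A : ℚAlgebra c ℓ) where
  open ℚAlgebra A
  open import Relation.Binary.Reasoning.Setoid setoid
  open ℚAlgebraProperties A using (ι-*-assoc; ι-pull)

  reflection : Carrier → Carrier
  reflection E = ι two * E + ι (ℚ.- 1ℚ)

  reflection-* : ∀ E F → reflection E * reflection F ≈
                 (ι four * (E * F) + ι (ℚ.- two) * E) + (ι (ℚ.- two) * F + 1#)
  reflection-* E F = begin
    (ι two * E + ι (ℚ.- 1ℚ)) * (ι two * F + ι (ℚ.- 1ℚ))
      ≈⟨ trans (distribʳ _ _ _) (+-cong (distribˡ _ _ _) (distribˡ _ _ _)) ⟩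
    ((ι two * E) * (ι two * F) + (ι two * E) * ι (ℚ.- 1ℚ)) + (ι (ℚ.- 1ℚ) * (ι two * F) + ι (ℚ.- 1ℚ) * ι (ℚ.- 1ℚ))
      ≈⟨ +-cong (+-cong scale² scale-neg) (+-cong (ι-*-assoc _ _ F) (sym (ι-* _ _))) ⟩
    (ι (two ℚ.* two) * (E * F) + ι (two ℚ.* ℚ.- 1ℚ) * E) + (ι (ℚ.- 1ℚ ℚ.* two) * F + ι (ℚ.- 1ℚ ℚ.* ℚ.- 1ℚ))
      ≈⟨ +-congˡ (+-congˡ ι-1) ⟩
    (ι four * (E * F) + ι (ℚ.- two) * E) + (ι (ℚ.- two) * F + 1#) ∎
    where
    scale² : (ι two * E) * (ι two * F) ≈ ι (two ℚ.* two) * (E * F)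
    scale² = trans (*-assoc _ _ _) (trans (*-congˡ (ι-pull two E F)) (ι-*-assoc two two (E * F)))
    scale-neg : (ι two * E) * ι (ℚ.- 1ℚ) ≈ ι (two ℚ.* ℚ.- 1ℚ) * E
    scale-neg = trans (*-assoc _ _ _) (trans (*-congˡ (sym (ι-central _ E))) (ι-*-assoc _ _ E))

  reflection-involutive : ∀ {E} → E * E ≈ E → reflection E * reflection E ≈ 1#
  reflection-involutive {E} E²≈E = begin
    reflection E * reflection E
      ≈⟨ reflection-* E E ⟩
    (ι four * (E * E) + ι (ℚ.- two) * E) + (ι (ℚ.- two) * E + 1#)
      ≈⟨ +-assoc _ _ _ ⟨
    ((ι four * (E * E) + ι (ℚ.- two) * E) + ι (ℚ.- two) * E) + 1#
      ≈⟨ +-congʳ (+-congʳ (+-congʳ (*-congˡ E²≈E))) ⟩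
    ((ι four * E + ι (ℚ.- two) * E) + ι (ℚ.- two) * E) + 1#
      ≈⟨ +-congʳ (trans (+-congʳ (sym (distribʳ _ _ _))) (sym (distribʳ _ _ _))) ⟩
    ((ι four + ι (ℚ.- two)) + ι (ℚ.- two)) * E + 1#
      ≈⟨ +-congʳ (*-congʳ (trans (+-congʳ (sym (ι-+ _ _))) (trans (sym (ι-+ _ _)) ι-0))) ⟩
    0# * E + 1#
      ≈⟨ trans (+-congʳ (zeroˡ E)) (+-identityˡ 1#) ⟩
    1# ∎

module Cos² {c ℓ} (A : ℚAlgebra c ℓ) where
  open ℚAlgebra A
  open import Algebra.Properties.Ring ring using (-‿distribˡ-*; -‿distribʳ-*; -‿+-comm)
  open import Algebra.Solver.CommutativeMonoid +-commutativeMonoid using (solve; _⊕_; _⊜_)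
  open import Relation.Binary.Reasoning.Setoid setoid

  -- 1 − (E − F)²; for orthogonal projections E, F it is cos² of the angle between their ranges.
  cos² : Carrier → Carrier → Carrier
  cos² E F = (1# - (E + F)) + (E * F + F * E)

  cos²-comm : ∀ E F → cos² E F ≈ cos² F E
  cos²-comm E F = +-cong (+-congˡ (-‿cong (+-comm E F))) (+-comm _ _)

  module _ {E F : Carrier} (E²≈E : E * E ≈ E) (F²≈F : F * F ≈ F) where

    private
      cancel : ∀ x y → (x - x) + y ≈ y
      cancel x y = trans (+-congʳ (-‿inverseʳ x)) (+-identityˡ y)

      -[E+F]*F : (- (E + F)) * F ≈ - (E * F) + - F
      -[E+F]*F = trans (sym (-‿distribˡ-* _ _))
                   (trans (-‿cong (trans (distribʳ _ _ _) (+-congˡ F²≈F))) (sym (-‿+-comm _ _)))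

      F*-[E+F] : F * (- (E + F)) ≈ - (F * E) + - F
      F*-[E+F] = trans (sym (-‿distribʳ-* _ _))
                   (trans (-‿cong (trans (distribˡ _ _ _) (+-congˡ F²≈F))) (sym (-‿+-comm _ _)))

    cos²-*ʳ : cos² E F * F ≈ F * (E * F)
    cos²-*ʳ = begin
      cos² E F * F
        ≈⟨ trans (distribʳ _ _ _) (+-cong (distribʳ _ _ _) (distribʳ _ _ _)) ⟩
      (1# * F + (- (E + F)) * F) + ((E * F) * F + (F * E) * F)
        ≈⟨ +-cong (+-cong (*-identityˡ F) -[E+F]*F) (+-cong (trans (*-assoc _ _ _) (*-congˡ F²≈F)) (*-assoc _ _ _)) ⟩
      (F + (- (E * F) + - F)) + (E * F + F * (E * F))
        ≈⟨ solve 5 (λ a b c d e → (a ⊕ (b ⊕ c)) ⊕ (d ⊕ e) ⊜ (a ⊕ c) ⊕ ((d ⊕ b) ⊕ e))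
                   refl F (- (E * F)) (- F) (E * F) (F * (E * F)) ⟩
      (F - F) + ((E * F - E * F) + F * (E * F))
        ≈⟨ trans (cancel F _) (cancel (E * F) _) ⟩
      F * (E * F) ∎

    cos²-*ˡ : F * cos² E F ≈ F * (E * F)
    cos²-*ˡ = begin
      F * cos² E F
        ≈⟨ trans (distribˡ _ _ _) (+-cong (distribˡ _ _ _) (distribˡ _ _ _)) ⟩
      (F * 1# + F * (- (E + F))) + (F * (E * F) + F * (F * E))
        ≈⟨ +-cong (+-cong (*-identityʳ F) F*-[E+F]) (+-congˡ (trans (sym (*-assoc _ _ _)) (*-congʳ F²≈F))) ⟩
      (F + (- (F * E) + - F)) + (F * (E * F) + F * E)
        ≈⟨ solve 5 (λ a b c d e → (a ⊕ (b ⊕ c)) ⊕ (e ⊕ d) ⊜ (a ⊕ c) ⊕ ((d ⊕ b) ⊕ e))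
                   refl F (- (F * E)) (- F) (F * E) (F * (E * F)) ⟩
      (F - F) + ((F * E - F * E) + F * (E * F))
        ≈⟨ trans (cancel F _) (cancel (F * E) _) ⟩
      F * (E * F) ∎

    cos²-commutesʳ : cos² E F * F ≈ F * cos² E F
    cos²-commutesʳ = trans cos²-*ʳ (sym cos²-*ˡ)

module IdempotentPair {c ℓ} (A : ℚAlgebra c ℓ) {P Q : ℚAlgebra.Carrier A}
  (P²≈P : ℚAlgebra._≈_ A (ℚAlgebra._*_ A P P) P) (Q²≈Q : ℚAlgebra._≈_ A (ℚAlgebra._*_ A Q Q) Q) where
  open ℚAlgebra A
  open RingSums ring using (product; product-commutes)
  open import Algebra.Properties.Semiring.Exp semiring using (_^_)
  open import Algebra.Properties.Ring ring using (-‿distribˡ-*; -‿distribʳ-*; -‿+-comm; -0#≈0#)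
  open import Algebra.Solver.CommutativeMonoid +-commutativeMonoid using (solve; _⊕_; _⊜_)
  open import Relation.Binary.Reasoning.Setoid setoid
  open Reflection A
  open Cos² A
  open ℚAlgebraProperties A using (ι-*-assoc; ι-pull; ι-neg1*)

  U Y : Carrier
  U = reflection P * reflection Q
  Y = cos² P Q

  Y-_ : ℚ → Carrier
  Y- a = ι (ℚ.- a) + Y

  Y*Q≈QPQ : Y * Q ≈ Q * (P * Q)
  Y*Q≈QPQ = cos²-*ʳ P²≈P Q²≈Q

  Y*P≈PQP : Y * P ≈ P * (Q * P)
  Y*P≈PQP = trans (*-congʳ (cos²-comm P Q)) (cos²-*ʳ Q²≈Q P²≈P)

  Y-commutes-Q : Y * Q ≈ Q * Y
  Y-commutes-Q = cos²-commutesʳ P²≈P Q²≈Q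

  Y-commutes-P : Y * P ≈ P * Y
  Y-commutes-P = trans (*-congʳ (cos²-comm P Q)) (trans (cos²-commutesʳ Q²≈Q P²≈P) (*-congˡ (cos²-comm Q P)))

  reflection-commutes : ∀ {X} → X * Y ≈ Y * X → reflection X * Y ≈ Y * reflection X
  reflection-commutes {X} XY≈YX = begin
    (ι two * X + ι (ℚ.- 1ℚ)) * Y
      ≈⟨ distribʳ _ _ _ ⟩
    (ι two * X) * Y + ι (ℚ.- 1ℚ) * Y
      ≈⟨ +-cong (trans (*-assoc _ _ _) (trans (*-congˡ XY≈YX) (sym (ι-pull two Y X)))) (ι-central _ Y) ⟩
    Y * (ι two * X) + Y * ι (ℚ.- 1ℚ)
      ≈⟨ distribˡ _ _ _ ⟨
    Y * (ι two * X + ι (ℚ.- 1ℚ)) ∎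

  U-commutes-Y : U * Y ≈ Y * U
  U-commutes-Y = begin
    (reflection P * reflection Q) * Y  ≈⟨ *-assoc _ _ _ ⟩
    reflection P * (reflection Q * Y)  ≈⟨ *-congˡ (reflection-commutes (sym Y-commutes-Q)) ⟩
    reflection P * (Y * reflection Q)  ≈⟨ *-assoc _ _ _ ⟨
    (reflection P * Y) * reflection Q  ≈⟨ *-congʳ (reflection-commutes (sym Y-commutes-P)) ⟩
    (Y * reflection P) * reflection Q  ≈⟨ *-assoc _ _ _ ⟩
    Y * (reflection P * reflection Q)  ∎

  U*U⁻¹≈1 : U * (reflection Q * reflection P) ≈ 1#
  U*U⁻¹≈1 = begin
    (reflection P * reflection Q) * (reflection Q * reflection P)
      ≈⟨ *-assoc _ _ _ ⟩
    reflection P * (reflection Q * (reflection Q * reflection P))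
      ≈⟨ *-congˡ (*-assoc _ _ _) ⟨
    reflection P * ((reflection Q * reflection Q) * reflection P)
      ≈⟨ *-congˡ (trans (*-congʳ (reflection-involutive Q²≈Q)) (*-identityˡ _)) ⟩
    reflection P * reflection P
      ≈⟨ reflection-involutive P²≈P ⟩
    1# ∎

  -- U is a rotation by twice the angle: U + U⁻¹ = 2 cos 2θ = 4 cos² θ − 2.
  U+U⁻¹ : U + reflection Q * reflection P ≈ ι four * Y + ι (ℚ.- two)
  U+U⁻¹ = begin
    U + reflection Q * reflection P
      ≈⟨ +-cong (reflection-* P Q) (reflection-* Q P) ⟩
    ((fPQ + tP) + (tQ + 1#)) + ((fQP + tQ) + (tP + 1#))
      ≈⟨ solve 5 (λ a b c d e → ((a ⊕ b) ⊕ (c ⊕ d)) ⊕ ((e ⊕ c) ⊕ (b ⊕ d)) ⊜ (((b ⊕ b) ⊕ (c ⊕ c)) ⊕ (a ⊕ e)) ⊕ (d ⊕ d))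
                 refl fPQ tP tQ 1# fQP ⟩
    (((tP + tP) + (tQ + tQ)) + (fPQ + fQP)) + (1# + 1#)
      ≈⟨ +-cong (+-cong (+-cong (doubled P) (doubled Q)) (sym (distribˡ _ _ _))) ones ⟩
    ((- (ι four * P) + - (ι four * Q)) + ι four * (P * Q + Q * P)) + (ι four + ι (ℚ.- two))
      ≈⟨ +-congʳ (+-congʳ (-‿+-comm _ _)) ⟩
    (- (ι four * P + ι four * Q) + ι four * (P * Q + Q * P)) + (ι four + ι (ℚ.- two))
      ≈⟨ solve 4 (λ n s f g → (n ⊕ s) ⊕ (f ⊕ g) ⊜ ((f ⊕ n) ⊕ s) ⊕ g) refl _ _ (ι four) (ι (ℚ.- two)) ⟩
    ((ι four + - (ι four * P + ι four * Q)) + ι four * (P * Q + Q * P)) + ι (ℚ.- two)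
      ≈⟨ +-congʳ (+-congʳ (+-cong (sym (*-identityʳ _)) (trans (-‿cong (sym (distribˡ _ _ _))) (-‿distribʳ-* _ _)))) ⟩
    ((ι four * 1# + ι four * - (P + Q)) + ι four * (P * Q + Q * P)) + ι (ℚ.- two)
      ≈⟨ +-congʳ (trans (+-congʳ (sym (distribˡ _ _ _))) (sym (distribˡ _ _ _))) ⟩
    ι four * Y + ι (ℚ.- two) ∎
    where
    fPQ fQP tP tQ : Carrier
    fPQ = ι four * (P * Q)
    fQP = ι four * (Q * P)
    tP = ι (ℚ.- two) * P
    tQ = ι (ℚ.- two) * Q
    doubled : ∀ E → ι (ℚ.- two) * E + ι (ℚ.- two) * E ≈ - (ι four * E)
    doubled E = trans (sym (distribʳ _ _ _))
                  (trans (*-congʳ (trans (sym (ι-+ _ _)) (ι-neg four))) (sym (-‿distribˡ-* _ _)))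
    ones : 1# + 1# ≈ ι four + ι (ℚ.- two)
    ones = trans (+-cong (sym ι-1) (sym ι-1)) (trans (sym (ι-+ 1ℚ 1ℚ)) (ι-+ four (ℚ.- two)))

  kernel-quadratic : ∀ a V → (Y- a) * V ≈ 0# → U * (U * V) ≈ ι (four ℚ.* a ℚ.- two) * (U * V) - V
  kernel-quadratic a V kills = begin
    U * (U * V)
      ≈⟨ trans (+-assoc _ _ _) (trans (+-congˡ (-‿inverseʳ V)) (+-identityʳ _)) ⟨
    (U * (U * V) + V) - V
      ≈⟨ +-congʳ (+-cong (sym (*-assoc _ _ _)) (sym (*-identityˡ V))) ⟩
    ((U * U) * V + 1# * V) - V
      ≈⟨ +-congʳ (trans (sym (distribʳ _ _ _)) (*-congʳ (+-congˡ (sym U*U⁻¹≈1)))) ⟩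
    (U * U + U * (reflection Q * reflection P)) * V - V
      ≈⟨ +-congʳ (trans (*-congʳ (sym (distribˡ _ _ _))) (*-assoc _ _ _)) ⟩
    U * ((U + reflection Q * reflection P) * V) - V
      ≈⟨ +-congʳ (*-congˡ (trans (*-congʳ U+U⁻¹) W-eigen)) ⟩
    U * (ι (four ℚ.* a ℚ.- two) * V) - V
      ≈⟨ +-congʳ (ι-pull _ U V) ⟩
    ι (four ℚ.* a ℚ.- two) * (U * V) - V ∎
    where
    YV≈aV : Y * V ≈ ι a * V
    YV≈aV = begin
      Y * V
        ≈⟨ +-identityˡ _ ⟨
      0# + Y * V
        ≈⟨ +-congʳ (-‿inverseˡ (ι (ℚ.- a) * V)) ⟨
      (- (ι (ℚ.- a) * V) + ι (ℚ.- a) * V) + Y * V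
        ≈⟨ trans (+-assoc _ _ _) (+-congˡ (trans (sym (distribʳ _ _ _)) kills)) ⟩
      - (ι (ℚ.- a) * V) + 0#
        ≈⟨ +-identityʳ _ ⟩
      - (ι (ℚ.- a) * V)
        ≈⟨ -‿distribˡ-* _ _ ⟩
      (- ι (ℚ.- a)) * V
        ≈⟨ *-congʳ (trans (sym (ι-neg _)) (reflexive (≡.cong ι (ℚ-RingProperties.-‿involutive a)))) ⟩
      ι a * V ∎
    W-eigen : (ι four * Y + ι (ℚ.- two)) * V ≈ ι (four ℚ.* a ℚ.- two) * V
    W-eigen = begin
      (ι four * Y + ι (ℚ.- two)) * V      ≈⟨ distribʳ _ _ _ ⟩
      (ι four * Y) * V + ι (ℚ.- two) * V  ≈⟨ +-congʳ (trans (*-assoc _ _ _) (trans (*-congˡ YV≈aV) (ι-*-assoc _ _ V))) ⟩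
      ι (four ℚ.* a) * V + ι (ℚ.- two) * V ≈⟨ trans (sym (distribʳ _ _ _)) (*-congʳ (sym (ι-+ _ _))) ⟩
      ι (four ℚ.* a ℚ.- two) * V          ∎

  private
    Y-commutes : ∀ a {Z} → Y * Z ≈ Z * Y → (Y- a) * Z ≈ Z * (Y- a)
    Y-commutes a {Z} YZ≈ZY = trans (distribʳ _ _ _) (trans (+-cong (ι-central _ Z) YZ≈ZY) (sym (distribˡ _ _ _)))

  Y-0≈Y : Y- 0ℚ ≈ Y
  Y-0≈Y = trans (+-congʳ ι-0) (+-identityˡ Y)

  module _ {k} (λs : Fin k → ℚ) (FQ≈0 : product (Y-_ ∘ λs) * Q ≈ 0#) where
    private
      F : Carrier
      F = product (Y-_ ∘ λs)

    F-commutes-P : F * P ≈ P * F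
    F-commutes-P = product-commutes (Y-_ ∘ λs) P (λ i → Y-commutes (λs i) Y-commutes-P)

    FY*Q≈0 : (F * Y) * Q ≈ 0#
    FY*Q≈0 = begin
      (F * Y) * Q        ≈⟨ trans (*-assoc _ _ _) (*-congˡ Y*Q≈QPQ) ⟩
      F * (Q * (P * Q))  ≈⟨ *-assoc _ _ _ ⟨
      (F * Q) * (P * Q)  ≈⟨ trans (*-congʳ FQ≈0) (zeroˡ _) ⟩
      0#                 ∎

    FY*P≈0 : (F * Y) * P ≈ 0#
    FY*P≈0 = begin
      (F * Y) * P        ≈⟨ trans (*-assoc _ _ _) (*-congˡ Y*P≈PQP) ⟩
      F * (P * (Q * P))  ≈⟨ trans (sym (*-assoc _ _ _)) (*-congʳ F-commutes-P) ⟩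
      (P * F) * (Q * P)  ≈⟨ trans (*-assoc _ _ _) (*-congˡ (sym (*-assoc _ _ _))) ⟩
      P * ((F * Q) * P)  ≈⟨ *-congˡ (trans (*-congʳ FQ≈0) (zeroˡ P)) ⟩
      P * 0#             ≈⟨ zeroʳ P ⟩
      0#                 ∎

    FY*Y≈FY : (F * Y) * Y ≈ F * Y
    FY*Y≈FY = begin
      r * ((1# - (P + Q)) + (P * Q + Q * P))
        ≈⟨ trans (distribˡ _ _ _) (+-cong (distribˡ _ _ _) (distribˡ _ _ _)) ⟩
      (r * 1# + r * - (P + Q)) + (r * (P * Q) + r * (Q * P))
        ≈⟨ +-cong (+-cong (*-identityʳ r) (trans (sym (-‿distribʳ-* _ _)) (-‿cong r*[P+Q]≈0)))
                  (trans (+-cong (kills-after FY*P≈0) (kills-after FY*Q≈0)) (+-identityˡ 0#)) ⟩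
      (r + - 0#) + 0#
        ≈⟨ trans (+-identityʳ _) (trans (+-congˡ -0#≈0#) (+-identityʳ r)) ⟩
      r ∎
      where
      r : Carrier
      r = F * Y
      r*[P+Q]≈0 : r * (P + Q) ≈ 0#
      r*[P+Q]≈0 = trans (distribˡ _ _ _) (trans (+-cong FY*P≈0 FY*Q≈0) (+-identityˡ 0#))
      kills-after : ∀ {E G} → r * E ≈ 0# → r * (E * G) ≈ 0#
      kills-after rE≈0 = trans (sym (*-assoc _ _ _)) (trans (*-congʳ rE≈0) (zeroˡ _))

    FY*[Y-1]≈0 : (F * Y) * (Y- 1ℚ) ≈ 0#
    FY*[Y-1]≈0 = begin
      (F * Y) * (ι (ℚ.- 1ℚ) + Y)          ≈⟨ distribˡ _ _ _ ⟩
      (F * Y) * ι (ℚ.- 1ℚ) + (F * Y) * Y  ≈⟨ +-cong (trans (sym (ι-central _ _)) (ι-neg1* _)) FY*Y≈FY ⟩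
      - (F * Y) + F * Y                   ≈⟨ -‿inverseˡ _ ⟩
      0#                                  ∎

    -- U¹² fixes the kernel of each factor of F·Y·(Y − 1), and that kernel is everything.
    U¹²≈1 : ∀ {τ} → 1 ≤ τ → U ^ τ ≈ 1# → U ^ 12 ≈ 1#
    U¹²≈1 1≤τ Uᵗ≈1 = trans (sym (*-identityʳ _)) (FY[Y-1]-kerFixed 1# (trans (*-identityʳ _) FY*[Y-1]≈0))
      where
      open ℚAlgebraPowers.FiniteOrder A U 1≤τ Uᵗ≈1 using (KerFixed; kerFixed-*; kerFixed-product; quadratic-fixed)
      Y-kerFixed : ∀ a → KerFixed 12 (Y- a)
      Y-kerFixed a V kills = quadratic-fixed _ V (kernel-quadratic a V kills)
      F-kerFixed : KerFixed 12 F
      F-kerFixed = kerFixed-product 12 (Y-_ ∘ λs) (Y-kerFixed ∘ λs) (λ i → Y-commutes (λs i) (sym U-commutes-Y))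
      FY-kerFixed : KerFixed 12 (F * Y)
      FY-kerFixed = kerFixed-* 12 F-kerFixed (λ V YV≈0 → Y-kerFixed 0ℚ V (trans (*-congʳ Y-0≈Y) YV≈0))
                               (sym U-commutes-Y)
      FY[Y-1]-kerFixed : KerFixed 12 ((F * Y) * (Y- 1ℚ))
      FY[Y-1]-kerFixed = kerFixed-* 12 FY-kerFixed (Y-kerFixed 1ℚ) (Y-commutes 1ℚ (sym U-commutes-Y))

-- Rational matrices and the Cayley–Hamilton theorem

-- Opened only here: its det, δ and sgn would clash with those defined inside Determinant.
open import Defs

module ℚ-Sums = CommutativeRingSums ℚ.+-*-commutativeRing
open ℚ-Sums using (∑; ∑-nil; ∑-suc; ∑-cong; ∑-+; ∑-comm; ∑-*ˡ; ∑-*ʳ; ∑-zero; ∑-punchIn; product)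

Σ≡∑ : ∀ {n} (f : Fin n → ℚ) → Σ[ f ] ≡ ∑ f
Σ≡∑ {zero}  f = ≡.sym (∑-nil f)
Σ≡∑ {suc n} f = ≡.trans (≡.cong (f zero ℚ.+_) (Σ≡∑ (f ∘ suc))) (≡.sym (∑-suc f))

Π≡product : ∀ {n} (f : Fin n → ℚ) → Π[ f ] ≡ product f
Π≡product {zero}  f = ≡.refl
Π≡product {suc n} f = ≡.cong (f zero ℚ.*_) (Π≡product (f ∘ suc))

⊗-entry : ∀ {m n k} (A : Mat m n) (B : Mat n k) i j → (A ⊗ B) i j ≡ ∑ (λ l → A i l ℚ.* B l j)
⊗-entry A B i j = Σ≡∑ _

∑-δˡ : ∀ {n} (i : Fin n) (f : Fin n → ℚ) → ∑ (λ l → δ i l ℚ.* f l) ≡ f i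
∑-δˡ {suc n} zero f = begin
  ∑ (λ l → δ zero l ℚ.* f l)
    ≡⟨ ∑-suc _ ⟩
  1ℚ ℚ.* f zero ℚ.+ ∑ (λ l → 0ℚ ℚ.* f (suc l))
    ≡⟨ ≡.cong₂ ℚ._+_ (ℚ.*-identityˡ (f zero)) (∑-zero (λ l → ℚ.*-zeroˡ (f (suc l)))) ⟩
  f zero ℚ.+ 0ℚ
    ≡⟨ ℚ.+-identityʳ (f zero) ⟩
  f zero ∎
  where open ≡.≡-Reasoning
∑-δˡ {suc n} (suc i) f = begin
  ∑ (λ l → δ (suc i) l ℚ.* f l)                    ≡⟨ ∑-suc _ ⟩
  0ℚ ℚ.* f zero ℚ.+ ∑ (λ l → δ i l ℚ.* f (suc l))  ≡⟨ ≡.cong₂ ℚ._+_ (ℚ.*-zeroˡ (f zero)) (∑-δˡ i (f ∘ suc)) ⟩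
  0ℚ ℚ.+ f (suc i)                                 ≡⟨ ℚ.+-identityˡ (f (suc i)) ⟩
  f (suc i)                                        ∎
  where open ≡.≡-Reasoning

δ-sym : ∀ {n} (i j : Fin n) → δ i j ≡ δ j i
δ-sym zero    zero    = ≡.refl
δ-sym zero    (suc j) = ≡.refl
δ-sym (suc i) zero    = ≡.refl
δ-sym (suc i) (suc j) = δ-sym i j

δ-refl : ∀ {n} (i : Fin n) → δ i i ≡ 1ℚ
δ-refl zero    = ≡.refl
δ-refl (suc i) = δ-refl i

δ-≢ : ∀ {n} {i j : Fin n} → i ≢ j → δ i j ≡ 0ℚ
δ-≢ {i = zero}  {zero}  i≢j = ⊥-elim (i≢j ≡.refl)
δ-≢ {i = zero}  {suc j} i≢j = ≡.refl
δ-≢ {i = suc i} {zero}  i≢j = ≡.refl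
δ-≢ {i = suc i} {suc j} i≢j = δ-≢ (i≢j ∘ ≡.cong suc)

∑-δʳ : ∀ {n} (j : Fin n) (f : Fin n → ℚ) → ∑ (λ l → f l ℚ.* δ l j) ≡ f j
∑-δʳ j f = ≡.trans (∑-cong (λ l → ≡.trans (ℚ.*-comm (f l) (δ l j)) (≡.cong (ℚ._* f l) (δ-sym l j)))) (∑-δˡ j f)

𝟎 : ∀ {m n} → Mat m n
𝟎 i j = 0ℚ

⊖_ : ∀ {m n} → Mat m n → Mat m n
(⊖ A) i j = ℚ.- A i j

module _ {m n : ℕ} where

  ≋-refl : {A : Mat m n} → A ≋ A
  ≋-refl i j = ≡.refl

  ≋-sym : {A B : Mat m n} → A ≋ B → B ≋ A
  ≋-sym A≋B i j = ≡.sym (A≋B i j)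

  ≋-trans : {A B C : Mat m n} → A ≋ B → B ≋ C → A ≋ C
  ≋-trans A≋B B≋C i j = ≡.trans (A≋B i j) (B≋C i j)

  ≋-setoid : Setoid 0ℓ 0ℓ
  ≋-setoid = record
    { Carrier = Mat m n ; _≈_ = _≋_
    ; isEquivalence = record { refl = ≋-refl ; sym = ≋-sym ; trans = ≋-trans } }

module _ {m n k : ℕ} where

  ⊗-cong : {A A′ : Mat m n} {B B′ : Mat n k} → A ≋ A′ → B ≋ B′ → (A ⊗ B) ≋ (A′ ⊗ B′)
  ⊗-cong A≋A′ B≋B′ i j = ≡.trans (Σ≡∑ _) (≡.trans (∑-cong (λ l → ≡.cong₂ ℚ._*_ (A≋A′ i l) (B≋B′ l j))) (≡.sym (Σ≡∑ _)))

  ⊗-distribˡ : (A : Mat m n) (B C : Mat n k) → (A ⊗ (B ⊕ C)) ≋ ((A ⊗ B) ⊕ (A ⊗ C))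
  ⊗-distribˡ A B C i j = ≡.trans (Σ≡∑ _) (≡.trans (∑-cong (λ l → ℚ.*-distribˡ-+ (A i l) (B l j) (C l j)))
    (≡.trans (∑-+ _ _) (≡.sym (≡.cong₂ ℚ._+_ (Σ≡∑ _) (Σ≡∑ _)))))

  ⊗-distribʳ : (A B : Mat m n) (C : Mat n k) → ((A ⊕ B) ⊗ C) ≋ ((A ⊗ C) ⊕ (B ⊗ C))
  ⊗-distribʳ A B C i j = ≡.trans (Σ≡∑ _) (≡.trans (∑-cong (λ l → ℚ.*-distribʳ-+ (C l j) (A i l) (B i l)))
    (≡.trans (∑-+ _ _) (≡.sym (≡.cong₂ ℚ._+_ (Σ≡∑ _) (Σ≡∑ _)))))

  ·-⊗ : ∀ a (A : Mat m n) (B : Mat n k) → ((a · A) ⊗ B) ≋ (a · (A ⊗ B))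
  ·-⊗ a A B i j = ≡.trans (Σ≡∑ _) (≡.trans (∑-cong (λ l → ℚ.*-assoc a (A i l) (B l j)))
    (≡.trans (∑-*ˡ a _) (≡.cong (a ℚ.*_) (≡.sym (Σ≡∑ _)))))

  ⊗-· : ∀ a (A : Mat m n) (B : Mat n k) → (A ⊗ (a · B)) ≋ (a · (A ⊗ B))
  ⊗-· a A B i j = ≡.trans (Σ≡∑ _) (≡.trans (∑-cong (λ l → swap (A i l) (B l j)))
    (≡.trans (∑-*ˡ a _) (≡.cong (a ℚ.*_) (≡.sym (Σ≡∑ _)))))
    where
    swap : ∀ x y → x ℚ.* (a ℚ.* y) ≡ a ℚ.* (x ℚ.* y)
    swap x y = ≡.trans (≡.sym (ℚ.*-assoc x a y)) (≡.trans (≡.cong (ℚ._* y) (ℚ.*-comm x a)) (ℚ.*-assoc a x y))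

  ⊗-zeroˡ : (A : Mat n k) → (𝟎 {m} ⊗ A) ≋ 𝟎
  ⊗-zeroˡ A i j = ≡.trans (Σ≡∑ _) (∑-zero (λ l → ℚ.*-zeroˡ (A l j)))

  ⊗-zeroʳ : (A : Mat m n) → (A ⊗ 𝟎 {n} {k}) ≋ 𝟎
  ⊗-zeroʳ A i j = ≡.trans (Σ≡∑ _) (∑-zero (λ l → ℚ.*-zeroʳ (A i l)))

module _ {m n : ℕ} where

  ⊗-identityˡ : (A : Mat m n) → (I ⊗ A) ≋ A
  ⊗-identityˡ A i j = ≡.trans (Σ≡∑ _) (∑-δˡ i (λ l → A l j))

  ⊗-identityʳ : (A : Mat m n) → (A ⊗ I) ≋ A
  ⊗-identityʳ A i j = ≡.trans (Σ≡∑ _) (∑-δʳ j (A i))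

⊗-assoc : ∀ {m n k p} (A : Mat m n) (B : Mat n k) (C : Mat k p) → ((A ⊗ B) ⊗ C) ≋ (A ⊗ (B ⊗ C))
⊗-assoc A B C i j = begin
  ((A ⊗ B) ⊗ C) i j                                ≡⟨ Σ≡∑ _ ⟩
  ∑ (λ l → (A ⊗ B) i l ℚ.* C l j)                  ≡⟨ ∑-cong (λ l → ≡.cong (ℚ._* C l j) (Σ≡∑ _)) ⟩
  ∑ (λ l → ∑ (λ t → A i t ℚ.* B t l) ℚ.* C l j)    ≡⟨ ∑-cong (λ l → ∑-*ʳ (C l j) (λ t → A i t ℚ.* B t l)) ⟨
  ∑ (λ l → ∑ (λ t → A i t ℚ.* B t l ℚ.* C l j))    ≡⟨ ∑-comm _ ⟩
  ∑ (λ t → ∑ (λ l → A i t ℚ.* B t l ℚ.* C l j))    ≡⟨ ∑-cong (λ t → ∑-cong (λ l → ℚ.*-assoc (A i t) (B t l) (C l j))) ⟩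
  ∑ (λ t → ∑ (λ l → A i t ℚ.* (B t l ℚ.* C l j)))  ≡⟨ ∑-cong (λ t → ∑-*ˡ (A i t) (λ l → B t l ℚ.* C l j)) ⟩
  ∑ (λ t → A i t ℚ.* ∑ (λ l → B t l ℚ.* C l j))    ≡⟨ ∑-cong (λ t → ≡.cong (A i t ℚ.*_) (Σ≡∑ _)) ⟨
  ∑ (λ t → A i t ℚ.* (B ⊗ C) t j)                  ≡⟨ Σ≡∑ _ ⟨
  (A ⊗ (B ⊗ C)) i j                                ∎
  where open ≡.≡-Reasoning

⊕-cong : ∀ {m n} {A A′ B B′ : Mat m n} → A ≋ A′ → B ≋ B′ → (A ⊕ B) ≋ (A′ ⊕ B′)
⊕-cong A≋A′ B≋B′ i j = ≡.cong₂ ℚ._+_ (A≋A′ i j) (B≋B′ i j)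

Mat-ring : ℕ → Ring 0ℓ 0ℓ
Mat-ring n = record
  { Carrier = Mat n n ; _≈_ = _≋_ ; _+_ = _⊕_ ; _*_ = _⊗_ ; -_ = ⊖_ ; 0# = 𝟎 ; 1# = I
  ; isRing = record
    { +-isAbelianGroup = record
      { isGroup = record
        { isMonoid = record
          { isSemigroup = record
            { isMagma = record { isEquivalence = Setoid.isEquivalence ≋-setoid ; ∙-cong = ⊕-cong }
            ; assoc = λ A B C i j → ℚ.+-assoc (A i j) (B i j) (C i j) }
          ; identity = (λ A i j → ℚ.+-identityˡ (A i j)) , (λ A i j → ℚ.+-identityʳ (A i j)) }
        ; inverse = (λ A i j → ℚ.+-inverseˡ (A i j)) , (λ A i j → ℚ.+-inverseʳ (A i j))
        ; ⁻¹-cong = λ A≋B i j → ≡.cong ℚ.-_ (A≋B i j) }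
      ; comm = λ A B i j → ℚ.+-comm (A i j) (B i j) }
    ; *-cong = ⊗-cong
    ; *-assoc = ⊗-assoc
    ; *-identity = ⊗-identityˡ , ⊗-identityʳ
    ; distrib = ⊗-distribˡ , (λ C A B → ⊗-distribʳ A B C) } }

·-congʳ : ∀ {m n} a {A B : Mat m n} → A ≋ B → (a · A) ≋ (a · B)
·-congʳ a A≋B i j = ≡.cong (a ℚ.*_) (A≋B i j)

scalar-⊗ : ∀ {m n} a (A : Mat m n) → ((a · I) ⊗ A) ≋ (a · A)
scalar-⊗ a A = ≋-trans (·-⊗ a I A) (·-congʳ a (⊗-identityˡ A))

⊗-scalar : ∀ {m n} a (A : Mat m n) → (A ⊗ (a · I)) ≋ (a · A)
⊗-scalar a A = ≋-trans (⊗-· a A I) (·-congʳ a (⊗-identityʳ A))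

Mat-ℚAlgebra : ℕ → ℚAlgebra 0ℓ 0ℓ
Mat-ℚAlgebra n = record
  { ring = Mat-ring n
  ; ι = λ a → a · I
  ; ι-isRingHomomorphism = mkIsRingHomomorphism _ (λ a≡b i j → ≡.cong (ℚ._* δ i j) a≡b)
      (λ a b i j → ℚ.*-distribʳ-+ (δ i j) a b)
      (λ a b → ≋-sym (≋-trans (scalar-⊗ a (b · I)) (λ i j → ≡.sym (ℚ.*-assoc a b (δ i j)))))
      (λ a i j → ≡.sym (ℚ-RingProperties.-‿distribˡ-* a (δ i j)))
      (λ i j → ℚ.*-zeroˡ (δ i j))
      (λ i j → ℚ.*-identityˡ (δ i j))
  ; ι-central = λ a A → ≋-trans (scalar-⊗ a A) (≋-sym (⊗-scalar a A))
  }

module _ {n : ℕ} where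
  open import Algebra.Properties.Semiring.Exp (Ring.semiring (Mat-ring n)) using (_^_)

  ^ᴹ≋^ : (A : Mat n n) (k : ℕ) → (A ^ᴹ k) ≋ (A ^ k)
  ^ᴹ≋^ A zero    = ≋-refl
  ^ᴹ≋^ A (suc k) = ⊗-cong {A = A} ≋-refl (^ᴹ≋^ A k)

  ∑ᴹ-entry : ∀ {k} (f : Fin k → Mat n n) i j → RingSums.∑ (Mat-ring n) f i j ≡ ∑ (λ l → f l i j)
  ∑ᴹ-entry {zero}  f i j = ≡.trans (RingSums.∑-nil (Mat-ring n) f i j) (≡.sym (∑-nil _))
  ∑ᴹ-entry {suc k} f i j = ≡.trans (RingSums.∑-suc (Mat-ring n) f i j)
    (≡.trans (≡.cong (f zero i j ℚ.+_) (∑ᴹ-entry (f ∘ suc) i j)) (≡.sym (∑-suc _)))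

module ℚ-Determinant = Determinant ℚ.+-*-commutativeRing

sgn≡ : ∀ k → sgn k ≡ ℚ-Determinant.sgn k
sgn≡ zero    = ≡.refl
sgn≡ (suc k) = ≡.cong ℚ.-_ (sgn≡ k)

det≡ : ∀ {n} (A : Mat n n) → det A ≡ ℚ-Determinant.det A
det≡ {zero}  A = ≡.refl
det≡ {suc n} A = ≡.trans (Σ≡∑ _) (∑-cong (λ j →
  ≡.cong₂ ℚ._*_ (≡.cong (ℚ._* A zero j) (sgn≡ (toℕ j))) (det≡ (λ r c → A (suc r) (punchIn j c)))))

module ℚ[X]-Determinant = Determinant ℚ[X]
open ℚ[X]-Determinant using () renaming (det to detₚ; δ to δₚ; adj to adjₚ)

evalℚ-det : ∀ x {n} (A : ℚ[X]-Determinant.SqMat n) → evalℚ x (detₚ A) ≡ ℚ-Determinant.det (λ i j → evalℚ x (A i j))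
evalℚ-det x = DeterminantHomomorphism.det-homo (eval-isRingHomomorphism ℚ-ℚAlgebra x)

evalMat : ∀ {n} → Mat n n → Pol → Mat n n
evalMat {n} = Evaluation.eval (Mat-ℚAlgebra n)

-- The characteristic matrix X·I − K, with entries in ℚ[X].
charMatrix : ∀ {n} → Mat n n → ℚ[X]-Determinant.SqMat n
charMatrix K i j = ℚ.- K i j ∷ δ i j ∷ []

module _ {n : ℕ} (K : Mat n n) where
  open Evaluation (Mat-ℚAlgebra n) using (eval-1)

  eval-δₚ : ∀ {m} (i k : Fin m) → evalMat K (δₚ i k) ≋ (δ i k · I)
  eval-δₚ zero    zero    = ≋-trans (eval-1 K) (λ r c → ≡.sym (ℚ.*-identityˡ (δ r c)))
  eval-δₚ zero    (suc k) r c = ≡.sym (ℚ.*-zeroˡ (δ r c))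
  eval-δₚ (suc i) zero    r c = ≡.sym (ℚ.*-zeroˡ (δ r c))
  eval-δₚ (suc i) (suc k) = eval-δₚ i k

  eval-charMatrix : ∀ i j → evalMat K (charMatrix K i j) ≋ (((ℚ.- K i j) · I) ⊕ (δ i j · K))
  eval-charMatrix i j r c = ≡.cong ((ℚ.- K i j ℚ.* δ r c) ℚ.+_) (K-term r c)
    where
    K-term : (K ⊗ ((δ i j · I) ⊕ (K ⊗ 𝟎))) ≋ (δ i j · K)
    K-term = ≋-trans (⊗-cong {A = K} ≋-refl drop-𝟎) (⊗-scalar (δ i j) K)
      where
      drop-𝟎 : ((δ i j · I) ⊕ (K ⊗ 𝟎)) ≋ (δ i j · I)
      drop-𝟎 r c = ≡.trans (≡.cong (δ i j ℚ.* δ r c ℚ.+_) (⊗-zeroʳ K r c)) (ℚ.+-identityʳ (δ i j ℚ.* δ r c))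

  charMatrix-columnSum : ∀ j l → ∑ (λ i → evalMat K (charMatrix K i j) l i) ≡ 0ℚ
  charMatrix-columnSum j l = begin
    ∑ (λ i → evalMat K (charMatrix K i j) l i)
      ≡⟨ ∑-cong (λ i → eval-charMatrix i j l i) ⟩
    ∑ (λ i → ℚ.- K i j ℚ.* δ l i ℚ.+ δ i j ℚ.* K l i)
      ≡⟨ ∑-+ _ _ ⟩
    ∑ (λ i → ℚ.- K i j ℚ.* δ l i) ℚ.+ ∑ (λ i → δ i j ℚ.* K l i)
      ≡⟨ ≡.cong₂ ℚ._+_ (≡.trans (∑-cong (λ i → ℚ.*-comm (ℚ.- K i j) (δ l i))) (∑-δˡ l (λ i → ℚ.- K i j)))
                       (≡.trans (∑-cong (λ i → ℚ.*-comm (δ i j) (K l i))) (∑-δʳ j (K l))) ⟩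
    ℚ.- K l j ℚ.+ K l j
      ≡⟨ ℚ.+-inverseˡ (K l j) ⟩
    0ℚ ∎
    where open ≡.≡-Reasoning

open ℚ[X]-Determinant.WithHalf (ℚ.½ ∷ []) (mk≈ₚ (λ x → ≡.refl)) using (adj-rightInverse)

-- Evaluate adj(XI − K)·(XI − K) = det(XI − K)·I at X = K entry by entry: the (r, k) entry of
-- det(XI − K)(K) becomes a combination of the column sums ∑ᵢ (Kδᵢⱼ − Kᵢⱼ)ₗᵢ, which all vanish.
cayleyHamilton : ∀ {n} (K : Mat n n) → evalMat K (detₚ (charMatrix K)) ≋ 𝟎
cayleyHamilton {zero}  K ()
cayleyHamilton {suc n} K r k = begin
  D r k                                  ≡⟨ ∑-δʳ k (D r) ⟨
  ∑ (λ i → D r i ℚ.* δ i k)              ≡⟨ ∑-cong adjugate-expansion ⟩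
  ∑ (λ i → ∑ (λ j → ∑ (λ l → T j l i)))  ≡⟨ ∑-comm _ ⟩
  ∑ (λ j → ∑ (λ i → ∑ (λ l → T j l i)))  ≡⟨ ∑-cong (λ j → ∑-comm _) ⟩
  ∑ (λ j → ∑ (λ l → ∑ (λ i → T j l i)))  ≡⟨ ∑-zero (λ j → ∑-zero (λ l → column-vanishes j l)) ⟩
  0ℚ                                     ∎
  where
  open ≡.≡-Reasoning
  A : ℚAlgebra 0ℓ 0ℓ
  A = Mat-ℚAlgebra (suc n)
  open Evaluation A using (eval-*)
  module ℚ[X] = CommutativeRing ℚ[X]
  𝔐 : ℚ[X]-Determinant.SqMat (suc n)
  𝔐 = charMatrix K
  E : Pol → Mat (suc n) (suc n)
  E = evalMat K
  D : Mat (suc n) (suc n)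
  D = E (detₚ 𝔐)
  T : Fin (suc n) → Fin (suc n) → Fin (suc n) → ℚ
  T j l i = E (adjₚ 𝔐 j k) r l ℚ.* E (𝔐 i j) l i

  adj-left : ∀ i → ℚ[X]-Determinant.∑ (λ j → adjₚ 𝔐 j k *ₚ 𝔐 i j) ℚ[X].≈ (δₚ i k *ₚ detₚ 𝔐)
  adj-left i = ℚ[X].trans (ℚ[X]-Determinant.∑-cong (λ j → ℚ[X].*-comm (adjₚ 𝔐 j k) (𝔐 i j))) (adj-rightInverse 𝔐 i k)

  adjugate-expansion : ∀ i → D r i ℚ.* δ i k ≡ ∑ (λ j → ∑ (λ l → T j l i))
  adjugate-expansion i = begin
    D r i ℚ.* δ i k
      ≡⟨ ℚ.*-comm (D r i) (δ i k) ⟩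
    δ i k ℚ.* D r i
      ≡⟨ scalar-⊗ (δ i k) D r i ⟨
    ((δ i k · I) ⊗ D) r i
      ≡⟨ ⊗-cong (eval-δₚ K i k) (≋-refl {A = D}) r i ⟨
    (E (δₚ i k) ⊗ D) r i
      ≡⟨ eval-* K (δₚ i k) (detₚ 𝔐) r i ⟨
    E (δₚ i k *ₚ detₚ 𝔐) r i
      ≡⟨ eval-cong A K (adj-left i) r i ⟨
    E (ℚ[X]-Determinant.∑ (λ j → adjₚ 𝔐 j k *ₚ 𝔐 i j)) r i
      ≡⟨ eval-∑ A K _ r i ⟩
    RingSums.∑ (Mat-ring (suc n)) (λ j → E (adjₚ 𝔐 j k *ₚ 𝔐 i j)) r i
      ≡⟨ ∑ᴹ-entry _ r i ⟩
    ∑ (λ j → E (adjₚ 𝔐 j k *ₚ 𝔐 i j) r i)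
      ≡⟨ ∑-cong (λ j → ≡.trans (eval-* K (adjₚ 𝔐 j k) (𝔐 i j) r i) (⊗-entry (E (adjₚ 𝔐 j k)) (E (𝔐 i j)) r i)) ⟩
    ∑ (λ j → ∑ (λ l → T j l i)) ∎

  column-vanishes : ∀ j l → ∑ (λ i → T j l i) ≡ 0ℚ
  column-vanishes j l = begin
    ∑ (λ i → T j l i)                               ≡⟨ ∑-*ˡ (E (adjₚ 𝔐 j k) r l) _ ⟩
    E (adjₚ 𝔐 j k) r l ℚ.* ∑ (λ i → E (𝔐 i j) l i)  ≡⟨ ≡.cong (E (adjₚ 𝔐 j k) r l ℚ.*_) (charMatrix-columnSum K j l) ⟩
    E (adjₚ 𝔐 j k) r l ℚ.* 0ℚ                       ≡⟨ ℚ.*-zeroʳ (E (adjₚ 𝔐 j k) r l) ⟩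
    0ℚ                                              ∎

module _ {n : ℕ} (K : Mat n n) (λs : Fin n → ℚ) where
  private
    A : ℚAlgebra 0ℓ 0ℓ
    A = Mat-ℚAlgebra n
    module Matₙ = ℚAlgebra A
    module ℚ[X] = CommutativeRing ℚ[X]
    open Evaluation A using (eval-X-)

  charPoly≈product : (∀ x → det ((x · I) ⊕ ((ℚ.- 1ℚ) · K)) ≡ Π[ (λ i → x ℚ.- λs i) ]) →
                     detₚ (charMatrix K) ≈ₚ RingSums.product ℚ[X].ring (λ i → X- λs i)
  charPoly≈product split = mk≈ₚ λ x → begin
    evalℚ x (detₚ (charMatrix K))
      ≡⟨ evalℚ-det x (charMatrix K) ⟩
    ℚ-Determinant.det (λ i j → evalℚ x (charMatrix K i j))
      ≡⟨ ℚ-Determinant.det-cong (λ i j → entry x (K i j) (δ i j)) ⟩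
    ℚ-Determinant.det ((x · I) ⊕ ((ℚ.- 1ℚ) · K))
      ≡⟨ det≡ ((x · I) ⊕ ((ℚ.- 1ℚ) · K)) ⟨
    det ((x · I) ⊕ ((ℚ.- 1ℚ) · K))
      ≡⟨ split x ⟩
    Π[ (λ i → x ℚ.- λs i) ]
      ≡⟨ Π≡product (λ i → x ℚ.- λs i) ⟩
    product (λ i → x ℚ.- λs i)
      ≡⟨ ℚ-Sums.product-cong (λ i → linear x (λs i)) ⟩
    product (λ i → evalℚ x (X- λs i))
      ≡⟨ eval-product ℚ-ℚAlgebra x (λ i → X- λs i) ⟨
    evalℚ x (RingSums.product ℚ[X].ring (λ i → X- λs i)) ∎
    where
    open ≡.≡-Reasoning
    open ℚ-Sums using (product)
    entry : ∀ x k d → ℚ.- k ℚ.+ x ℚ.* (d ℚ.+ x ℚ.* 0ℚ) ≡ x ℚ.* d ℚ.+ (ℚ.- 1ℚ) ℚ.* k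
    entry = solve-∀ ℚ-almostCommutativeRing
    linear : ∀ x a → x ℚ.- a ≡ ℚ.- a ℚ.+ x ℚ.* (1ℚ ℚ.+ x ℚ.* 0ℚ)
    linear = solve-∀ ℚ-almostCommutativeRing

  splitCharPoly⇒product≋𝟎 : (∀ x → det ((x · I) ⊕ ((ℚ.- 1ℚ) · K)) ≡ Π[ (λ i → x ℚ.- λs i) ]) →
                            RingSums.product Matₙ.ring (λ i → ((ℚ.- λs i) · I) ⊕ K) ≋ 𝟎
  splitCharPoly⇒product≋𝟎 split = begin
    RingSums.product Matₙ.ring (λ i → ((ℚ.- λs i) · I) ⊕ K)
      ≈⟨ RingSums.product-cong Matₙ.ring (λ i → Matₙ.sym (eval-X- K (λs i))) ⟩
    RingSums.product Matₙ.ring (λ i → evalMat K (X- λs i))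
      ≈⟨ eval-product A K (λ i → X- λs i) ⟨
    evalMat K (RingSums.product ℚ[X].ring (λ i → X- λs i))
      ≈⟨ eval-cong A K (charPoly≈product split) ⟨
    evalMat K (detₚ (charMatrix K))
      ≈⟨ cayleyHamilton K ⟩
    𝟎 ∎
    where open import Relation.Binary.Reasoning.Setoid Matₙ.setoid

-- Incidence matrices of orientable maps

∑-nonNeg : ∀ {n} (f : Fin n → ℚ) → (∀ i → 0ℚ ℚ.≤ f i) → 0ℚ ℚ.≤ ∑ f
∑-nonNeg {zero}  f _     = ℚ.≤-reflexive (≡.sym (∑-nil f))
∑-nonNeg {suc n} f f≥0 = begin
  0ℚ                      ≡⟨ ℚ.+-identityˡ 0ℚ ⟨
  0ℚ ℚ.+ 0ℚ               ≤⟨ ℚ.+-mono-≤ (f≥0 zero) (∑-nonNeg (f ∘ suc) (f≥0 ∘ suc)) ⟩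
  f zero ℚ.+ ∑ (f ∘ suc)  ≡⟨ ∑-suc f ⟨
  ∑ f                     ∎
  where open ℚ.≤-Reasoning

term≤∑ : ∀ {n} (f : Fin n → ℚ) → (∀ i → 0ℚ ℚ.≤ f i) → ∀ j → f j ℚ.≤ ∑ f
term≤∑ {suc n} f f≥0 j = begin
  f j                        ≡⟨ ℚ.+-identityʳ (f j) ⟨
  f j ℚ.+ 0ℚ                 ≤⟨ ℚ.+-monoʳ-≤ (f j) (∑-nonNeg (f ∘ punchIn j) (f≥0 ∘ punchIn j)) ⟩
  f j ℚ.+ ∑ (f ∘ punchIn j)  ≡⟨ ∑-punchIn j f ⟩
  ∑ f                        ∎
  where open ℚ.≤-Reasoning

inv-inverseˡ : ∀ p → p ≢ 0ℚ → inv p ℚ.* p ≡ 1ℚ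
inv-inverseˡ p p≢0 with p ℚ.≟ 0ℚ
... | yes p≡0 = ⊥-elim (p≢0 p≡0)
... | no  p≢0 = ℚ.*-inverseˡ p {{ℚ.≢-nonZero p≢0}}

-- N is the 0/1 matrix of a surjection t, so Nᵀ N is diagonal with the (positive) fibre sizes of t.
module IncidenceMatrix {m k : ℕ} (t : Fin m → Fin k) (t-surjective : ∀ w → ∃ λ a → t a ≡ w)
  (N : Mat m k) (N-yes : ∀ {a w} → t a ≡ w → N a w ≡ 1ℚ) (N-no : ∀ {a w} → t a ≢ w → N a w ≡ 0ℚ) where

  Gram : Mat k k
  Gram = N ᵀ ⊗ N

  Projection : Mat m m
  Projection = N ⊗ diagInv Gram ⊗ N ᵀ

  Gram-entry : ∀ w w′ → Gram w w′ ≡ ∑ (λ a → N a w ℚ.* N a w′)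
  Gram-entry w w′ = ⊗-entry (N ᵀ) N w w′

  N-square-nonNeg : ∀ a w → 0ℚ ℚ.≤ N a w ℚ.* N a w
  N-square-nonNeg a w with t a Fin.≟ w
  ... | yes ta≡w = ℚ.≤-trans (ℚ.<⇒≤ (ℚ.positive⁻¹ 1ℚ)) (ℚ.≤-reflexive (≡.sym (≡.cong₂ ℚ._*_ (N-yes ta≡w) (N-yes ta≡w))))
  ... | no  ta≢w = ℚ.≤-reflexive (≡.sym (≡.trans (≡.cong (ℚ._* N a w) (N-no ta≢w)) (ℚ.*-zeroˡ (N a w))))

  Gram-diagonal≢0 : ∀ w → Gram w w ≢ 0ℚ
  Gram-diagonal≢0 w Gww≡0 with t-surjective w
  ... | a , ta≡w = ℚ.<-irrefl ≡.refl (ℚ.<-≤-trans (ℚ.positive⁻¹ 1ℚ) (begin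
    1ℚ                         ≡⟨ ≡.cong₂ ℚ._*_ (N-yes ta≡w) (N-yes ta≡w) ⟨
    N a w ℚ.* N a w            ≤⟨ term≤∑ (λ a → N a w ℚ.* N a w) (λ a → N-square-nonNeg a w) a ⟩
    ∑ (λ a → N a w ℚ.* N a w)  ≡⟨ ≡.trans (≡.sym (Gram-entry w w)) Gww≡0 ⟩
    0ℚ                         ∎))
    where open ℚ.≤-Reasoning

  Gram-offDiagonal : ∀ {w w′} → w ≢ w′ → Gram w w′ ≡ 0ℚ
  Gram-offDiagonal {w} {w′} w≢w′ = ≡.trans (Gram-entry w w′) (∑-zero term≡0)
    where
    term≡0 : ∀ a → N a w ℚ.* N a w′ ≡ 0ℚ
    term≡0 a with t a Fin.≟ w
    ... | yes ta≡w = ≡.trans (≡.cong (N a w ℚ.*_) (N-no (λ ta≡w′ → w≢w′ (≡.trans (≡.sym ta≡w) ta≡w′))))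
                             (ℚ.*-zeroʳ (N a w))
    ... | no  ta≢w = ≡.trans (≡.cong (ℚ._* N a w′) (N-no ta≢w)) (ℚ.*-zeroˡ (N a w′))

  diagInv-Gram : (diagInv Gram ⊗ Gram) ≋ I
  diagInv-Gram w w′ = begin
    (diagInv Gram ⊗ Gram) w w′                          ≡⟨ ⊗-entry (diagInv Gram) Gram w w′ ⟩
    ∑ (λ u → δ w u ℚ.* inv (Gram w w) ℚ.* Gram u w′)    ≡⟨ ∑-cong (λ u → ℚ.*-assoc (δ w u) _ _) ⟩
    ∑ (λ u → δ w u ℚ.* (inv (Gram w w) ℚ.* Gram u w′))  ≡⟨ ∑-δˡ w (λ u → inv (Gram w w) ℚ.* Gram u w′) ⟩
    inv (Gram w w) ℚ.* Gram w w′                        ≡⟨ row w w′ ⟩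
    δ w w′                                              ∎
    where
    open ≡.≡-Reasoning
    row : ∀ w w′ → inv (Gram w w) ℚ.* Gram w w′ ≡ δ w w′
    row w w′ with w Fin.≟ w′
    ... | yes ≡.refl = ≡.trans (inv-inverseˡ _ (Gram-diagonal≢0 w)) (≡.sym (δ-refl w))
    ... | no  w≢w′   = ≡.trans (≡.cong (inv (Gram w w) ℚ.*_) (Gram-offDiagonal w≢w′))
                               (≡.trans (ℚ.*-zeroʳ (inv (Gram w w))) (≡.sym (δ-≢ w≢w′)))

  Projection-⊗-N : (Projection ⊗ N) ≋ N
  Projection-⊗-N = begin
    ((N ⊗ diagInv Gram) ⊗ N ᵀ) ⊗ N  ≈⟨ ⊗-assoc (N ⊗ diagInv Gram) (N ᵀ) N ⟩
    (N ⊗ diagInv Gram) ⊗ Gram       ≈⟨ ⊗-assoc N (diagInv Gram) Gram ⟩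
    N ⊗ (diagInv Gram ⊗ Gram)       ≈⟨ ⊗-cong {A = N} ≋-refl diagInv-Gram ⟩
    N ⊗ I                           ≈⟨ ⊗-identityʳ N ⟩
    N                               ∎
    where open import Relation.Binary.Reasoning.Setoid ≋-setoid

  Projection-idempotent : (Projection ⊗ Projection) ≋ Projection
  Projection-idempotent = begin
    Projection ⊗ ((N ⊗ diagInv Gram) ⊗ N ᵀ)
      ≈⟨ ⊗-assoc Projection (N ⊗ diagInv Gram) (N ᵀ) ⟨
    (Projection ⊗ (N ⊗ diagInv Gram)) ⊗ N ᵀ
      ≈⟨ ⊗-cong {B = N ᵀ} (≋-sym (⊗-assoc Projection N (diagInv Gram))) ≋-refl ⟩
    ((Projection ⊗ N) ⊗ diagInv Gram) ⊗ N ᵀ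
      ≈⟨ ⊗-cong {B = N ᵀ} (⊗-cong {B = diagInv Gram} Projection-⊗-N ≋-refl) ≋-refl ⟩
    (N ⊗ diagInv Gram) ⊗ N ᵀ ∎
    where open import Relation.Binary.Reasoning.Setoid ≋-setoid

module MapOperators {nA nV nF} (X : OrientableMap nA nV nF) where
  open OrientableMap X
  open MapMatrices X

  ind-yes : ∀ {k} {x y : Fin k} → x ≡ y → ind x y ≡ 1ℚ
  ind-yes {x = x} {y} x≡y with x Fin.≟ y
  ... | yes _   = ≡.refl
  ... | no  x≢y = ⊥-elim (x≢y x≡y)

  ind-no : ∀ {k} {x y : Fin k} → x ≢ y → ind x y ≡ 0ℚ
  ind-no {x = x} {y} x≢y with x Fin.≟ y
  ... | yes x≡y = ⊥-elim (x≢y x≡y)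
  ... | no  _   = ≡.refl

  module Vertices = IncidenceMatrix tail tail-surj N ind-yes ind-no
  module Faces    = IncidenceMatrix face face-surj M ind-yes ind-no

  open IdempotentPair (Mat-ℚAlgebra nA) Faces.Projection-idempotent Vertices.Projection-idempotent public
    using (Y; Y-_; U¹²≈1; Y*Q≈QPQ) renaming (U to U′)
  open import Algebra.Properties.Semiring.Exp (Ring.semiring (Mat-ring nA)) using (_^_; ^-congˡ)

  private
    Dv : Mat nV nV
    Dv = diagInv D
    Df : Mat nF nF
    Df = diagInv Δ

  -- Both sides reassociate to N (D⁻¹ (Nᵀ (M (Δ⁻¹ (Mᵀ N))))).
  Y⊗N≋N⊗K : (Y ⊗ N) ≋ (N ⊗ K)
  Y⊗N≋N⊗K = begin
    Y ⊗ N
      ≈⟨ ⊗-cong {A = Y} ≋-refl (≋-sym Vertices.Projection-⊗-N) ⟩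
    Y ⊗ (Q ⊗ N)
      ≈⟨ ⊗-assoc Y Q N ⟨
    (Y ⊗ Q) ⊗ N
      ≈⟨ ⊗-cong {B = N} Y*Q≈QPQ ≋-refl ⟩
    (Q ⊗ (P ⊗ Q)) ⊗ N
      ≈⟨ ⊗-assoc Q (P ⊗ Q) N ⟩
    Q ⊗ ((P ⊗ Q) ⊗ N)
      ≈⟨ ⊗-cong {A = Q} ≋-refl (≋-trans (⊗-assoc P Q N) (⊗-cong {A = P} ≋-refl Vertices.Projection-⊗-N)) ⟩
    Q ⊗ (P ⊗ N)
      ≈⟨ ≋-trans (⊗-assoc (N ⊗ Dv) (N ᵀ) (P ⊗ N)) (⊗-assoc N Dv (N ᵀ ⊗ (P ⊗ N))) ⟩
    N ⊗ (Dv ⊗ (N ᵀ ⊗ (P ⊗ N)))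
      ≈⟨ ⊗-cong {A = N} ≋-refl (⊗-cong {A = Dv} ≋-refl (⊗-cong {A = N ᵀ} ≋-refl PN)) ⟩
    N ⊗ (Dv ⊗ (N ᵀ ⊗ (M ⊗ (Df ⊗ (M ᵀ ⊗ N)))))
      ≈⟨ ⊗-cong {A = N} ≋-refl K-normal ⟨
    N ⊗ K ∎
    where
    open import Relation.Binary.Reasoning.Setoid ≋-setoid
    PN : (P ⊗ N) ≋ (M ⊗ (Df ⊗ (M ᵀ ⊗ N)))
    PN = ≋-trans (⊗-assoc (M ⊗ Df) (M ᵀ) N) (⊗-assoc M Df (M ᵀ ⊗ N))
    K-normal : K ≋ (Dv ⊗ (N ᵀ ⊗ (M ⊗ (Df ⊗ (M ᵀ ⊗ N)))))
    K-normal = ≋-trans (⊗-assoc (((Dv ⊗ N ᵀ) ⊗ M) ⊗ Df) (M ᵀ) N) (≋-trans (⊗-assoc ((Dv ⊗ N ᵀ) ⊗ M) Df (M ᵀ ⊗ N))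
                 (≋-trans (⊗-assoc (Dv ⊗ N ᵀ) M (Df ⊗ (M ᵀ ⊗ N))) (⊗-assoc Dv (N ᵀ) (M ⊗ (Df ⊗ (M ᵀ ⊗ N))))))

  Y-⊗N : ∀ a → ((Y- a) ⊗ N) ≋ (N ⊗ (((ℚ.- a) · I) ⊕ K))
  Y-⊗N a = begin
    (((ℚ.- a) · I) ⊕ Y) ⊗ N
      ≈⟨ ⊗-distribʳ ((ℚ.- a) · I) Y N ⟩
    (((ℚ.- a) · I) ⊗ N) ⊕ (Y ⊗ N)
      ≈⟨ ⊕-cong (≋-trans (scalar-⊗ (ℚ.- a) N) (≋-sym (⊗-scalar (ℚ.- a) N))) Y⊗N≋N⊗K ⟩
    (N ⊗ ((ℚ.- a) · I)) ⊕ (N ⊗ K)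
      ≈⟨ ⊗-distribˡ N ((ℚ.- a) · I) K ⟨
    N ⊗ (((ℚ.- a) · I) ⊕ K) ∎
    where open import Relation.Binary.Reasoning.Setoid ≋-setoid

  product-Y-⊗N : ∀ {k} (λs : Fin k → ℚ) →
    (RingSums.product (Mat-ring nA) (Y-_ ∘ λs) ⊗ N) ≋ (N ⊗ RingSums.product (Mat-ring nV) (λ i → ((ℚ.- λs i) · I) ⊕ K))
  product-Y-⊗N {zero}  λs = ≋-trans (⊗-identityˡ N) (≋-sym (⊗-identityʳ N))
  product-Y-⊗N {suc k} λs = begin
    (F₀ ⊗ F) ⊗ N  ≈⟨ ⊗-assoc F₀ F N ⟩
    F₀ ⊗ (F ⊗ N)  ≈⟨ ⊗-cong {A = F₀} ≋-refl (product-Y-⊗N (λs ∘ suc)) ⟩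
    F₀ ⊗ (N ⊗ G)  ≈⟨ ⊗-assoc F₀ N G ⟨
    (F₀ ⊗ N) ⊗ G  ≈⟨ ⊗-cong {B = G} (Y-⊗N (λs zero)) ≋-refl ⟩
    (N ⊗ G₀) ⊗ G  ≈⟨ ⊗-assoc N G₀ G ⟩
    N ⊗ (G₀ ⊗ G)  ∎
    where
    open import Relation.Binary.Reasoning.Setoid ≋-setoid
    F₀ F : Mat nA nA
    F₀ = Y- λs zero
    F = RingSums.product (Mat-ring nA) (Y-_ ∘ λs ∘ suc)
    G₀ G : Mat nV nV
    G₀ = ((ℚ.- λs zero) · I) ⊕ K
    G = RingSums.product (Mat-ring nV) (λ i → ((ℚ.- λs (suc i)) · I) ⊕ K)

  product-Y-⊗Q≋𝟎 : (λs : Fin nV → ℚ) → (∀ x → charPolyCCᵀ x ≡ Π[ (λ i → x ℚ.- λs i) ]) →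
                   (RingSums.product (Mat-ring nA) (Y-_ ∘ λs) ⊗ Q) ≋ 𝟎
  product-Y-⊗Q≋𝟎 λs split = begin
    F ⊗ ((N ⊗ Dv) ⊗ N ᵀ)
      ≈⟨ ⊗-assoc F (N ⊗ Dv) (N ᵀ) ⟨
    (F ⊗ (N ⊗ Dv)) ⊗ N ᵀ
      ≈⟨ ⊗-cong {B = N ᵀ} (≋-sym (⊗-assoc F N Dv)) ≋-refl ⟩
    ((F ⊗ N) ⊗ Dv) ⊗ N ᵀ
      ≈⟨ ⊗-cong {B = N ᵀ} (⊗-cong {B = Dv} (product-Y-⊗N λs) ≋-refl) ≋-refl ⟩
    ((N ⊗ G) ⊗ Dv) ⊗ N ᵀ
      ≈⟨ ⊗-cong {B = N ᵀ} (⊗-cong {B = Dv} (⊗-cong {A = N} ≋-refl (splitCharPoly⇒product≋𝟎 K λs split)) ≋-refl) ≋-refl ⟩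
    ((N ⊗ 𝟎) ⊗ Dv) ⊗ N ᵀ
      ≈⟨ ⊗-cong {B = N ᵀ} (≋-trans (⊗-cong {B = Dv} (⊗-zeroʳ N) ≋-refl) (⊗-zeroˡ Dv)) ≋-refl ⟩
    𝟎 ⊗ N ᵀ
      ≈⟨ ⊗-zeroˡ (N ᵀ) ⟩
    𝟎 ∎
    where
    open import Relation.Binary.Reasoning.Setoid ≋-setoid
    F : Mat nA nA
    F = RingSums.product (Mat-ring nA) (Y-_ ∘ λs)
    G : Mat nV nV
    G = RingSums.product (Mat-ring nV) (λ i → ((ℚ.- λs i) · I) ⊕ K)

  U≋U′ : U ≋ U′
  U≋U′ = ⊗-cong (reflection≋ P) (reflection≋ Q)
    where
    reflection≋ : ∀ E → (((1ℚ ℚ.+ 1ℚ) · E) ⊕ ((ℚ.- 1ℚ) · I)) ≋ (((two · I) ⊗ E) ⊕ ((ℚ.- 1ℚ) · I))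
    reflection≋ E = ⊕-cong (≋-sym (scalar-⊗ two E)) ≋-refl

  U^≋U′^ : ∀ k → (U ^ᴹ k) ≋ (U′ ^ k)
  U^≋U′^ k = ≋-trans (^ᴹ≋^ U k) (^-congˡ k U≋U′)

divisor-of-12 : ∀ {τ} → 1 < τ → τ ∣ 12 → τ ≡ 2 ⊎ τ ≡ 3 ⊎ τ ≡ 4 ⊎ τ ≡ 6 ⊎ τ ≡ 12
divisor-of-12 {τ} 1<τ τ∣12 = go τ (∣⇒≤ τ∣12) 1<τ τ∣12
  where
  go : ∀ τ → τ ≤ 12 → 1 < τ → τ ∣ 12 → τ ≡ 2 ⊎ τ ≡ 3 ⊎ τ ≡ 4 ⊎ τ ≡ 6 ⊎ τ ≡ 12
  go 2  _ _ _ = inj₁ ≡.refl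
  go 3  _ _ _ = inj₂ (inj₁ ≡.refl)
  go 4  _ _ _ = inj₂ (inj₂ (inj₁ ≡.refl))
  go 6  _ _ _ = inj₂ (inj₂ (inj₂ (inj₁ ≡.refl)))
  go 12 _ _ _ = inj₂ (inj₂ (inj₂ (inj₂ ≡.refl)))
  go 5  _ _ d = ⊥-elim (from-no (5 ∣? 12) d)
  go 7  _ _ d = ⊥-elim (from-no (7 ∣? 12) d)
  go 8  _ _ d = ⊥-elim (from-no (8 ∣? 12) d)
  go 9  _ _ d = ⊥-elim (from-no (9 ∣? 12) d)
  go 10 _ _ d = ⊥-elim (from-no (10 ∣? 12) d)
  go 11 _ _ d = ⊥-elim (from-no (11 ∣? 12) d)
  go 0 _ () _
  go 1 _ (s≤s ()) _
  go (suc (suc (suc (suc (suc (suc (suc (suc (suc (suc (suc (suc (suc _)))))))))))))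
     (s≤s (s≤s (s≤s (s≤s (s≤s (s≤s (s≤s (s≤s (s≤s (s≤s (s≤s (s≤s ())))))))))))) _ _

lemma6p6 : ∀ {nA nV nF} (X : OrientableMap nA nV nF) →
    MapMatrices.OnlyRationalEigenvalues X →
    (τ : ℕ) → 1 < τ →
    (MapMatrices.U X ^ᴹ τ) ≋ I →
    (∀ s → 1 ≤ s → s < τ → ¬ ((MapMatrices.U X ^ᴹ s) ≋ I)) →
    τ ≡ 2 ⊎ τ ≡ 3 ⊎ τ ≡ 4 ⊎ τ ≡ 6 ⊎ τ ≡ 12
lemma6p6 {nA} X (λs , split) τ 1<τ Uᵗ≋I minimal =
  divisor-of-12 1<τ (order-∣ 1≤τ U′ᵗ≈1 U′-minimal U′¹²≈1)
  where
  open MapOperators X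
  open SemiringPowers (Ring.semiring (Mat-ring nA)) using (order-∣)
  open import Algebra.Properties.Semiring.Exp (Ring.semiring (Mat-ring nA)) using (_^_)
  1≤τ : 1 ≤ τ
  1≤τ = ℕ.<⇒≤ 1<τ
  U′ᵗ≈1 : (U′ ^ τ) ≋ I
  U′ᵗ≈1 = ≋-trans (≋-sym (U^≋U′^ τ)) Uᵗ≋I
  U′-minimal : ∀ s → 1 ≤ s → s < τ → ¬ ((U′ ^ s) ≋ I)
  U′-minimal s 1≤s s<τ U′ˢ≈1 = minimal s 1≤s s<τ (≋-trans (U^≋U′^ s) U′ˢ≈1)
  U′¹²≈1 : (U′ ^ 12) ≋ I
  U′¹²≈1 = U¹²≈1 λs (product-Y-⊗Q≋𝟎 λs split) 1≤τ U′ᵗ≈1
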